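{- Let $A=\mathrm{diag}(a_1,\dots,a_n)$ and $B=\mathrm{diag}(b_1,\dots,b_n)$ with all $a_i,b_i$ nonzero rationals, and let $AB=\mathrm{diag}(a_1b_1,\dots,a_nb_n)$. Then for every prime $p$, \[H(AB,p)=H(A,p)\,H(B,p)\,(\Delta A,\Delta B)_p\prod_{i=1}^n(a_i,b_i)_p,\] where $\Delta A$, $\Delta B$ are the discriminants of $A$ and $B$.
   Context: For nonzero rationals $a,b$ and a prime $p$, the Hilbert symbol $(a,b)_p$ is $1$ if $ax^2+by^2=z^2$ has a solution $(x,y,z)\neq(0,0,0)$ in the $p$-adic numbers $\mathbb{Q}_p$, and $-1$ otherwise. For a diagonal form $Q=\mathrm{diag}(q_1,\dots,q_n)$, the Hasse–Minkowski (local) invariant at $p$ is $H(Q,p)=\prod_{i<j}(q_i,q_j)_p$. The discriminant $\Delta Q$ is the square-free integer $s$ with $q_1\cdots q_n=sr^2$ for a rational $r$. -}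

module Defs where

open import Data.Nat as ℕ using (ℕ; zero; suc; _^_)
import Data.Nat.Divisibility as ℕD
open import Data.Integer as ℤ using (ℤ; +_; -[1+_]; ∣_∣)
open import Data.Integer.Divisibility as ℤD using ()
open import Data.Rational as ℚ using (ℚ; ↥_; ↧_; 0ℚ; 1ℚ; _/_)
open import Data.Vec using (Vec; []; _∷_; zipWith)
open import Data.Product using (Σ; ∃; _×_)
open import Data.Sum using (_⊎_)
open import Relation.Binary.PropositionalEquality using (_≡_; _≢_)
open import Relation.Nullary using (¬_)

_≡_[mod_] : ℤ → ℤ → ℕ → Set
x ≡ y [mod m ] = (+ m) ℤD.∣ (x ℤ.- y)

-- The p-adic integers ℤ_p = lim ℤ/p^k, as coherent sequences of integer
-- representatives: x (suc k) ≡ x k (mod p^k).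
record ℤ[_] (p : ℕ) : Set where
  field
    res : ℕ → ℤ
    coh : ∀ k → res (suc k) ≡ res k [mod p ^ k ]
open ℤ[_] public

IsZero : ∀ {p} → ℤ[ p ] → Set
IsZero {p} x = ∀ k → res x k ≡ + 0 [mod p ^ k ]

-- a x² + b y² = z² has a nontrivial solution in ℚ_p.
-- Writing a = ↥a/↧a, b = ↥b/↧b, multiplying through by ↧a·↧b and clearing
-- p-power denominators of x,y,z (homogeneity), this is: there exist
-- x, y, z ∈ ℤ_p, not all zero, with
--   (↥a ↧b) x² + (↥b ↧a) y² = (↧a ↧b) z²   in ℤ_p.
Solvable : ℕ → ℚ → ℚ → Set
Solvable p a b =
  Σ ℤ[ p ] λ x → Σ ℤ[ p ] λ y → Σ ℤ[ p ] λ z →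
    ¬ (IsZero x × IsZero y × IsZero z) ×
    (∀ k → ((↥ a ℤ.* ↧ b) ℤ.* (res x k ℤ.* res x k)
             ℤ.+ (↥ b ℤ.* ↧ a) ℤ.* (res y k ℤ.* res y k))
           ≡ ((↧ a ℤ.* ↧ b) ℤ.* (res z k ℤ.* res z k)) [mod p ^ k ])

IsHilbertSymbol : ℕ → (ℚ → ℚ → ℤ) → Set
IsHilbertSymbol p h = ∀ a b → a ≢ 0ℚ → b ≢ 0ℚ →
  (h a b ≡ + 1 × Solvable p a b) ⊎ (h a b ≡ -[1+ 0 ] × ¬ Solvable p a b)

prodWith : ∀ {n} → (ℚ → ℤ) → Vec ℚ n → ℤ
prodWith f [] = + 1
prodWith f (q ∷ qs) = f q ℤ.* prodWith f qs

Hasse : (ℚ → ℚ → ℤ) → ∀ {n} → Vec ℚ n → ℤ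
Hasse h [] = + 1
Hasse h (q ∷ qs) = prodWith (h q) qs ℤ.* Hasse h qs

prodPairs : (ℚ → ℚ → ℤ) → ∀ {n} → Vec ℚ n → Vec ℚ n → ℤ
prodPairs h [] [] = + 1
prodPairs h (a ∷ as) (b ∷ bs) = h a b ℤ.* prodPairs h as bs

prodℚ : ∀ {n} → Vec ℚ n → ℚ
prodℚ [] = 1ℚ
prodℚ (q ∷ qs) = q ℚ.* prodℚ qs

SquareFree : ℤ → Set
SquareFree s = s ≢ + 0 × (∀ d → (d ℕ.* d) ℕD.∣ ∣ s ∣ → d ≡ 1)

IsDiscriminant : ∀ {n} → Vec ℚ n → ℤ → Set
IsDiscriminant q s = SquareFree s × ∃ λ r → prodℚ q ≡ (s / 1) ℚ.* (r ℚ.* r)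

toℚ : ℤ → ℚ
toℚ s = s / 1

-- The Hilbert symbol is symmetric, takes the values ±1 and is multiplicative in each argument.  For any such
-- symbol the identity is bookkeeping: expanding (aᵢbᵢ, aⱼbⱼ) gives H(A) H(B) ∏_{i≠j} (aᵢ, bⱼ), the product
-- (∏a, ∏b) = ∏_{i,j} (aᵢ, bⱼ) equals that off-diagonal product times ∏ᵢ (aᵢ, bᵢ), and ∏a, ∏b differ from
-- ΔA, ΔB by squares.
--
-- Multiplicativity is the real content.  Write a nonzero integer as t² pᵅ u with u a p-adic unit.  Whether
-- m x² + n y² = z² has a nontrivial p-adic zero depends only on the data (α, u), (β, v) of m and n: Hensel
-- lifting turns suitable approximate solutions into solutions, and a descent shows there are none when every
-- zero modulo a fixed power of p is divisible by p.  For odd p this yields the classical criterion in terms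
-- of quadratic residues mod p, multiplicative because a product of two non-residues is a residue (a
-- pigeonhole count); for p = 2 it yields (-1)^(ε(u)ε(v) + α ω(v) + β ω(u)) with ε, ω read off u, v mod 8.
module Submission where

open import Level using (0ℓ)
open import Algebra.Bundles using (module CommutativeMonoid)
import Algebra.Properties.CommutativeSemigroup as CommutativeSemigroupProperties
open import Data.Bool as Bool using (Bool; true; false; _xor_; _∧_; if_then_else_)
open import Data.Bool.Solver using (module xor-∧-Solver)
open import Data.Empty using (⊥-elim)
open import Data.Fin as Fin using (Fin; zero; suc; toℕ; fromℕ<; splitAt; join; punchOut)
import Data.Fin.Properties as FinP
open import Data.Integer as ℤ using (ℤ; +_; -[1+_]; _+_; _*_; _-_; -_; 0ℤ; 1ℤ)
import Data.Integer.DivMod as ℤDM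
open import Data.Integer.Divisibility.Signed
import Data.Integer.Properties as ℤP
open import Data.Integer.Tactic.RingSolver using (solve-∀)
open import Data.Nat as ℕ using (ℕ; zero; suc)
open import Data.Nat.Coprimality using (Coprime; coprime-Bézout)
import Data.Nat.Divisibility as ℕD
open import Data.Nat.GCD using (module Bézout)
open import Data.Nat.Primality using (Prime; prime?; euclidsLemma; prime⇒nonZero; prime⇒nonTrivial; prime⇒irreducible)
import Data.Nat.Properties as ℕP
open import Data.Product using (Σ; ∃; _×_; _,_; proj₁; proj₂)
open import Data.Product.Properties using (≡-dec)
open import Data.Rational as ℚ using (ℚ; ↥_; ↧_; 0ℚ; 1ℚ)
import Data.Rational.Properties as ℚP
open import Data.Sum using (_⊎_; inj₁; inj₂)
open import Data.Unit using (⊤; tt)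
open import Data.Vec using (Vec; []; _∷_; lookup; zipWith)
open import Function using (_∘_; id)
open import Function.Bundles using (_⇔_; mk⇔; module Equivalence)
open import Function.Properties.Equivalence using (⇔-setoid)
open import Relation.Binary.Bundles using (Setoid)
open import Relation.Binary.Definitions using (tri<; tri≈; tri>)
open import Relation.Binary.PropositionalEquality as ≡ using (_≡_; _≢_; cong; subst)
import Relation.Binary.Reasoning.Setoid as SetoidReasoning
open import Relation.Nullary using (¬_; Dec; yes; no)
open import Relation.Nullary.Decidable using (True; toWitness; map′; _×-dec_; _→-dec_)
open import Defs


∣-respʳ : ∀ {d x y} → x ≡ y → d ∣ x → d ∣ y
∣-respʳ ≡.refl d∣x = d∣x

*-pres-∣ : ∀ {d e x y} → d ∣ x → e ∣ y → d * e ∣ x * y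
*-pres-∣ {d} {e} (divides q ≡.refl) (divides r ≡.refl) = divides (q * r) (rearrange q d r e)
  where
  rearrange : ∀ q d r e → q * d * (r * e) ≡ q * r * (d * e)
  rearrange = solve-∀

*-≢0 : ∀ {a b} → a ≢ 0ℤ → b ≢ 0ℤ → a * b ≢ 0ℤ
*-≢0 {a} a≢0 b≢0 ab≡0 with ℤP.i*j≡0⇒i≡0∨j≡0 a ab≡0
... | inj₁ a≡0 = a≢0 a≡0
... | inj₂ b≡0 = b≢0 b≡0

m*n∣⇒m∣ : ∀ {m n k} → m * n ∣ k → m ∣ k
m*n∣⇒m∣ {n = n} = ∣-trans (∣m⇒∣m*n n ∣-refl)

-- A data type, unlike the function _≡_[mod_] of Defs, so that x, y and m can be inferred from it.
infix 4 _≡_⟨mod_⟩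

data _≡_⟨mod_⟩ (x y m : ℤ) : Set where
  congruent : m ∣ x - y → x ≡ y ⟨mod m ⟩

module Mod {m : ℤ} where

  divides-diff : ∀ {x y} → x ≡ y ⟨mod m ⟩ → m ∣ x - y
  divides-diff (congruent m∣x-y) = m∣x-y

  reflexive : ∀ {x y} → x ≡ y → x ≡ y ⟨mod m ⟩
  reflexive {x} ≡.refl = congruent (∣-respʳ (≡.sym (ℤP.+-inverseʳ x)) (divides 0ℤ ≡.refl))

  refl : ∀ {x} → x ≡ x ⟨mod m ⟩
  refl = reflexive ≡.refl

  sym : ∀ {x y} → x ≡ y ⟨mod m ⟩ → y ≡ x ⟨mod m ⟩
  sym {x} {y} (congruent d) = congruent (∣-respʳ (negate x y) (∣m⇒∣-m d))
    where
    negate : ∀ x y → - (x - y) ≡ y - x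
    negate = solve-∀

  trans : ∀ {x y z} → x ≡ y ⟨mod m ⟩ → y ≡ z ⟨mod m ⟩ → x ≡ z ⟨mod m ⟩
  trans {x} {y} {z} (congruent d) (congruent e) = congruent (∣-respʳ (telescope x y z) (∣m∣n⇒∣m+n d e))
    where
    telescope : ∀ x y z → (x - y) + (y - z) ≡ x - z
    telescope = solve-∀

  +-cong : ∀ {a b c d} → a ≡ b ⟨mod m ⟩ → c ≡ d ⟨mod m ⟩ → a + c ≡ b + d ⟨mod m ⟩
  +-cong {a} {b} {c} {d} (congruent e) (congruent f) = congruent (∣-respʳ (regroup a b c d) (∣m∣n⇒∣m+n e f))
    where
    regroup : ∀ a b c d → (a - b) + (c - d) ≡ (a + c) - (b + d)
    regroup = solve-∀

  -‿cong : ∀ {a b} → a ≡ b ⟨mod m ⟩ → - a ≡ - b ⟨mod m ⟩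
  -‿cong {a} {b} (congruent d) = congruent (∣-respʳ (negate a b) (∣m⇒∣-m d))
    where
    negate : ∀ a b → - (a - b) ≡ - a - - b
    negate = solve-∀

  *-cong : ∀ {a b c d} → a ≡ b ⟨mod m ⟩ → c ≡ d ⟨mod m ⟩ → a * c ≡ b * d ⟨mod m ⟩
  *-cong {a} {b} {c} {d} (congruent e) (congruent f) =
    congruent (∣-respʳ (regroup a b c d) (∣m∣n⇒∣m+n (∣m⇒∣m*n c e) (∣n⇒∣m*n b f)))
    where
    regroup : ∀ a b c d → (a - b) * c + b * (c - d) ≡ a * c - b * d
    regroup = solve-∀

  *-congˡ : ∀ c {a b} → a ≡ b ⟨mod m ⟩ → c * a ≡ c * b ⟨mod m ⟩
  *-congˡ c = *-cong (refl {c})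

  *-congʳ : ∀ c {a b} → a ≡ b ⟨mod m ⟩ → a * c ≡ b * c ⟨mod m ⟩
  *-congʳ c a≡b = *-cong a≡b (refl {c})

  ∣⇒≡0 : ∀ {x} → m ∣ x → x ≡ 0ℤ ⟨mod m ⟩
  ∣⇒≡0 {x} m∣x = congruent (∣-respʳ (≡.sym (ℤP.+-identityʳ x)) m∣x)

  ≡0⇒∣ : ∀ {x} → x ≡ 0ℤ ⟨mod m ⟩ → m ∣ x
  ≡0⇒∣ {x} (congruent d) = ∣-respʳ (ℤP.+-identityʳ x) d

  weaken : ∀ {d x y} → d ∣ m → x ≡ y ⟨mod m ⟩ → x ≡ y ⟨mod d ⟩
  weaken d∣m (congruent m∣x-y) = congruent (∣-trans d∣m m∣x-y)

  dec : ∀ x y → Dec (x ≡ y ⟨mod m ⟩)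
  dec x y with m ∣? x - y
  ... | yes d = yes (congruent d)
  ... | no ¬d = no λ x≡y → ¬d (divides-diff x≡y)

  setoid : Setoid 0ℓ 0ℓ
  setoid = record
    { Carrier = ℤ
    ; _≈_ = _≡_⟨mod m ⟩
    ; isEquivalence = record { refl = refl ; sym = sym ; trans = trans }
    }

module ModReasoning (m : ℤ) = SetoidReasoning (Mod.setoid {m})

-- Opened only here: Mod defines its own refl, sym and trans.
open ≡ using (refl; sym; trans; cong₂; subst₂; module ≡-Reasoning)

halve : ∀ n → Σ ℕ λ j → n ≡ j ℕ.+ j ⊎ n ≡ suc (j ℕ.+ j)
halve zero = 0 , inj₁ refl
halve (suc n) with halve n
... | j , inj₁ n≡2j = j , inj₂ (cong suc n≡2j)
... | j , inj₂ n≡2j+1 = suc j , inj₁ (cong suc (trans n≡2j+1 (sym (ℕP.+-suc j j))))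

≡%ℕ : ∀ t d .{{_ : ℕ.NonZero d}} → t ≡ + (t ℤ.%ℕ d) ⟨mod + d ⟩
≡%ℕ t d = congruent (divides (t ℤ./ℕ d) (trans (cong (_- r) (ℤDM.a≡a%ℕn+[a/ℕn]*n t d)) (cancel r ((t ℤ./ℕ d) * + d))))
  where
  r = + (t ℤ.%ℕ d)
  cancel : ∀ a b → a + b - a ≡ b
  cancel = solve-∀

module PrimeArithmetic (p : ℕ) (pr : Prime p) where

  instance
    p≢0 : ℕ.NonZero p
    p≢0 = prime⇒nonZero pr

  P : ℤ
  P = + p

  P^_ : ℕ → ℤ
  P^ k = + (p ℕ.^ k)

  infix 8 P^_

  1<p : 1 ℕ.< p
  1<p = ℕ.nonTrivial⇒n>1 p {{prime⇒nonTrivial pr}}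

  P^-suc : ∀ k → P^ suc k ≡ P * P^ k
  P^-suc k = ℤP.pos-* p (p ℕ.^ k)

  P^-+ : ∀ i k → P^ (i ℕ.+ k) ≡ P^ i * P^ k
  P^-+ i k = trans (cong +_ (ℕP.^-distribˡ-+-* p i k)) (ℤP.pos-* (p ℕ.^ i) (p ℕ.^ k))

  P^1 : P^ 1 ≡ P
  P^1 = cong +_ (ℕP.*-identityʳ p)

  P^≢0 : ∀ k → P^ k ≢ 0ℤ
  P^≢0 k e = ℕ.≢-nonZero⁻¹ (p ℕ.^ k) {{ℕP.m^n≢0 p k}} (ℤP.+-injective e)

  P^0∣ : ∀ {x} → P^ 0 ∣ x
  P^0∣ {x} = divides x (sym (ℤP.*-identityʳ x))

  P^-weaken : ∀ i k {x} → P^ (i ℕ.+ k) ∣ x → P^ k ∣ x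
  P^-weaken i k = m*n∣⇒m∣ ∘ subst (_∣ _) (trans (P^-+ i k) (ℤP.*-comm (P^ i) (P^ k)))

  P^-suc-weaken : ∀ k {x} → P^ suc k ∣ x → P^ k ∣ x
  P^-suc-weaken = P^-weaken 1

  P^-suc⇒P : ∀ k {x} → P^ suc k ∣ x → P ∣ x
  P^-suc⇒P k h = m*n∣⇒m∣ (subst (_∣ _) (P^-suc k) h)

  P^-*-P : ∀ k {x y} → P^ k ∣ x → P ∣ y → P^ suc k ∣ x * y
  P^-*-P k {x} {y} a b = subst (_∣ x * y) (trans (ℤP.*-comm (P^ k) P) (sym (P^-suc k))) (*-pres-∣ a b)

  P-*-cancelˡ-∣ : ∀ {x y} → P * x ∣ P * y → x ∣ y
  P-*-cancelˡ-∣ = *-cancelˡ-∣ P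

  P∣x*y⇒P∣x⊎P∣y : ∀ x y → P ∣ x * y → P ∣ x ⊎ P ∣ y
  P∣x*y⇒P∣x⊎P∣y x y h with euclidsLemma ℤ.∣ x ∣ ℤ.∣ y ∣ pr (subst (p ℕD.∣_) (ℤP.abs-* x y) (∣⇒∣ᵤ h))
  ... | inj₁ p∣x = inj₁ (∣ᵤ⇒∣ p∣x)
  ... | inj₂ p∣y = inj₂ (∣ᵤ⇒∣ p∣y)

  Unit : ℤ → Set
  Unit u = ¬ (P ∣ u)

  Unit-* : ∀ {a b} → Unit a → Unit b → Unit (a * b)
  Unit-* {a} {b} ua ub h with P∣x*y⇒P∣x⊎P∣y a b h
  ... | inj₁ P∣a = ua P∣a
  ... | inj₂ P∣b = ub P∣b

  Unit-1 : Unit 1ℤ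
  Unit-1 h = ℕP.<⇒≢ 1<p (sym (ℕD.∣1⇒≡1 (∣⇒∣ᵤ h)))

  Unit-neg : ∀ {a} → Unit a → Unit (- a)
  Unit-neg {a} ua d = ua (∣-respʳ (ℤP.neg-involutive a) (∣m⇒∣-m d))

  Unit-resp-≡mod : ∀ {a b} → a ≡ b ⟨mod P ⟩ → Unit a → Unit b
  Unit-resp-≡mod a≡b ua P∣b = ua (Mod.≡0⇒∣ (Mod.trans a≡b (Mod.∣⇒≡0 P∣b)))

  P∣x²⇒P∣x : ∀ {x} → P ∣ x * x → P ∣ x
  P∣x²⇒P∣x {x} d with P∣x*y⇒P∣x⊎P∣y x x d
  ... | inj₁ P∣x = P∣x
  ... | inj₂ P∣x = P∣x

  unit-*-cancel : ∀ {u} → Unit u → ∀ k {x} → P^ k ∣ u * x → P^ k ∣ x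
  unit-*-cancel uu zero h = P^0∣
  unit-*-cancel {u} uu (suc k) {x} h with P∣x*y⇒P∣x⊎P∣y u x (P^-suc⇒P k h)
  ... | inj₁ P∣u = ⊥-elim (uu P∣u)
  ... | inj₂ (divides q refl) =
    P^-*-P k (unit-*-cancel uu k (P-*-cancelˡ-∣ P^k·P∣P·uq)) ∣-refl
    where
    shuffle : ∀ u q P → u * (q * P) ≡ P * (u * q)
    shuffle = solve-∀
    P^k·P∣P·uq : P * P^ k ∣ P * (u * q)
    P^k·P∣P·uq = subst₂ _∣_ (P^-suc k) (shuffle u q P) h

  record Factorisation (c : ℤ) : Set where
    constructor factorisation
    field
      valuation : ℕ
      unitPart : ℤ
      unit : Unit unitPart
      factorised : c ≡ P^ valuation * unitPart

  private
    factoriseBelow : ∀ n c → ℤ.∣ c ∣ ℕ.≤ n → c ≢ 0ℤ → Factorisation c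
    factoriseBelow n c _ c≢0 with P ∣? c
    ... | no P∤c = factorisation 0 c P∤c (sym (ℤP.*-identityˡ c))
    factoriseBelow zero c ∣c∣≤0 c≢0 | yes _ = ⊥-elim (c≢0 (ℤP.∣i∣≡0⇒i≡0 (ℕP.n≤0⇒n≡0 ∣c∣≤0)))
    factoriseBelow (suc n) c ∣c∣≤n c≢0 | yes (divides q refl) =
      factorisation (suc v) u uu (trans (cong (_* P) eq) (trans (shuffle (P^ v) u P) (cong (_* u) (sym (P^-suc v)))))
      where
      shuffle : ∀ a u P → a * u * P ≡ P * a * u
      shuffle = solve-∀
      q≢0 : q ≢ 0ℤ
      q≢0 q≡0 = c≢0 (cong (_* P) q≡0)
      ∣q∣<∣c∣ : ℤ.∣ q ∣ ℕ.< ℤ.∣ q * P ∣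
      ∣q∣<∣c∣ = subst (ℤ.∣ q ∣ ℕ.<_) (sym (ℤP.abs-* q P))
                  (ℕP.m<m*n ℤ.∣ q ∣ p {{ℕ.≢-nonZero (λ e → q≢0 (ℤP.∣i∣≡0⇒i≡0 e))}} 1<p)
      open Factorisation (factoriseBelow n q (ℕP.≤-pred (ℕP.≤-trans ∣q∣<∣c∣ ∣c∣≤n)) q≢0)
        renaming (valuation to v; unitPart to u; unit to uu; factorised to eq)

  factorise : ∀ c → c ≢ 0ℤ → Factorisation c
  factorise c = factoriseBelow _ c ℕP.≤-refl

-- Nontrivial p-adic zeros of diagonal ternary forms

Isotropic : ℕ → ℤ → ℤ → ℤ → Set
Isotropic p A B C =
  Σ ℤ[ p ] λ x → Σ ℤ[ p ] λ y → Σ ℤ[ p ] λ z →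
    ¬ (IsZero x × IsZero y × IsZero z) ×
    (∀ k → (A * (res x k * res x k) + B * (res y k * res y k)) ≡ (C * (res z k * res z k)) [mod p ℕ.^ k ])

Solvableℤ : ℕ → ℤ → ℤ → Set
Solvableℤ p m n = Isotropic p m n 1ℤ

Isotropic-swap : ∀ {p A B C} → Isotropic p A B C → Isotropic p B A C
Isotropic-swap {p} {A} {B} {C} (x , y , z , nontrivial , eq) =
  y , x , z , (λ (y≈0 , x≈0 , z≈0) → nontrivial (x≈0 , y≈0 , z≈0)) ,
  λ k → subst (λ t → t ≡ _ [mod p ℕ.^ k ]) (ℤP.+-comm (A * (res x k * res x k)) _) (eq k)

Solvableℤ-sym : ∀ {p m n} → Solvableℤ p m n → Solvableℤ p n m
Solvableℤ-sym {p} {m} {n} = Isotropic-swap {p} {m} {n} {1ℤ}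

Solvableℤ-comm : ∀ {p} m n → Solvableℤ p m n ⇔ Solvableℤ p n m
Solvableℤ-comm {p} m n = mk⇔ (Solvableℤ-sym {p} {m} {n}) (Solvableℤ-sym {p} {n} {m})

form : ℤ → ℤ → ℤ → ℤ → ℤ → ℤ
form m n x y z = m * (x * x) + n * (y * y) - z * z

module PAdicIntegers (p : ℕ) (pr : Prime p) where
  open PrimeArithmetic p pr

  coh-∣ : (x : ℤ[ p ]) → ∀ k → P^ k ∣ res x (suc k) - res x k
  coh-∣ x k = ∣ᵤ⇒∣ {P^ k} {res x (suc k) - res x k} (coh x k)

  coh-mod : (x : ℤ[ p ]) → ∀ k → res x (suc k) ≡ res x k ⟨mod P^ k ⟩
  coh-mod x k = congruent (coh-∣ x k)

  res-coherent : (x : ℤ[ p ]) → ∀ i k → P^ k ∣ res x (i ℕ.+ k) - res x k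
  res-coherent x zero k = ∣-respʳ (sym (ℤP.+-inverseʳ (res x k))) (divides 0ℤ refl)
  res-coherent x (suc i) k = ∣-respʳ (telescope (res x (suc (i ℕ.+ k))) (res x (i ℕ.+ k)) (res x k))
    (∣m∣n⇒∣m+n (P^-weaken i k (coh-∣ x (i ℕ.+ k))) (res-coherent x i k))
    where
    telescope : ∀ a b c → (a - b) + (b - c) ≡ a - c
    telescope = solve-∀

  isZero⇒∣ : (x : ℤ[ p ]) → IsZero x → ∀ k → P^ k ∣ res x k
  isZero⇒∣ x x≈0 k = ∣-respʳ (ℤP.+-identityʳ (res x k)) (∣ᵤ⇒∣ {P^ k} {res x k - + 0} (x≈0 k))

  isZero-from-later : (x : ℤ[ p ]) → (∀ k → ∃ λ i → P^ k ∣ res x (i ℕ.+ k)) → IsZero x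
  isZero-from-later x later k = ∣⇒∣ᵤ (∣-respʳ (cancel (res x (i ℕ.+ k)) (res x k))
                                     (∣m∣n⇒∣m-n P^k∣xᵢ₊ₖ (res-coherent x i k)))
    where
    cancel : ∀ a b → a - (a - b) ≡ b - + 0
    cancel = solve-∀
    i = proj₁ (later k)
    P^k∣xᵢ₊ₖ = proj₂ (later k)

  const : ℤ → ℤ[ p ]
  const c = record { res = λ _ → c ; coh = λ k → ∣⇒∣ᵤ (Mod.divides-diff (Mod.refl {P^ k} {c})) }

  infixl 7 _*ₚ_
  _*ₚ_ : ℤ[ p ] → ℤ[ p ] → ℤ[ p ]
  s *ₚ x = record
    { res = λ k → res s k * res x k
    ; coh = λ k → ∣⇒∣ᵤ (Mod.divides-diff (Mod.*-cong (coh-mod s k) (coh-mod x k)))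
    }

  const-*-isZero : ∀ c → c ≢ 0ℤ → (x : ℤ[ p ]) → IsZero (const c *ₚ x) → IsZero x
  const-*-isZero c c≢0 x cx≈0 = isZero-from-later x λ k →
    v , unit-*-cancel uu k {res x (v ℕ.+ k)} (*-cancelˡ-∣ (P^ v) {{ℤ.≢-nonZero (P^≢0 v)}} (shifted k))
    where
    open Factorisation (factorise c c≢0) renaming (valuation to v; unitPart to u; unit to uu; factorised to c≡P^v·u)
    shifted : ∀ k → P^ v * P^ k ∣ P^ v * (u * res x (v ℕ.+ k))
    shifted k = subst (_∣ P^ v * (u * res x (v ℕ.+ k))) (P^-+ v k)
      (∣-respʳ (trans (cong (_* res x (v ℕ.+ k)) c≡P^v·u) (ℤP.*-assoc (P^ v) u _)) (isZero⇒∣ (const c *ₚ x) cx≈0 (v ℕ.+ k)))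

  unit-res : (s : ℤ[ p ]) → Unit (res s 1) → ∀ k → Unit (res s (suc k))
  unit-res s unit k P∣sₖ₊₁ = unit (∣-respʳ (cancel (res s (suc k)) (res s 1))
      (∣m∣n⇒∣m-n P∣sₖ₊₁ (subst (λ i → P ∣ res s i - res s 1) (ℕP.+-comm k 1)
                                (subst (_∣ res s (k ℕ.+ 1) - res s 1) P^1 (res-coherent s k 1)))))
    where
    cancel : ∀ a b → a - (a - b) ≡ b
    cancel = solve-∀

  unit-*-isZero : (s x : ℤ[ p ]) → Unit (res s 1) → IsZero (s *ₚ x) → IsZero x
  unit-*-isZero s x unit sx≈0 = isZero-from-later x λ where
    zero → 0 , P^0∣
    (suc k) → 0 , unit-*-cancel (unit-res s unit k) (suc k) (isZero⇒∣ (s *ₚ x) sx≈0 (suc k))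

  unit-nonzero : (s : ℤ[ p ]) → Unit (res s 1) → ¬ IsZero s
  unit-nonzero s unit s≈0 = unit (subst (_∣ res s 1) P^1 (isZero⇒∣ s s≈0 1))

module HilbertEquation (p : ℕ) (pr : Prime p) where
  open PrimeArithmetic p pr
  open PAdicIntegers p pr

  Isotropic-transfer : ∀ {A B C} A′ B′ C′ cx cy cz l → cx ≢ 0ℤ → cy ≢ 0ℤ → cz ≢ 0ℤ →
                       A′ * (cx * cx) ≡ l * A → B′ * (cy * cy) ≡ l * B → C′ * (cz * cz) ≡ l * C →
                       Isotropic p A B C → Isotropic p A′ B′ C′
  Isotropic-transfer {A} {B} {C} A′ B′ C′ cx cy cz l cx≢0 cy≢0 cz≢0 eA eB eC (x , y , z , nontrivial , eq) =
    const cx *ₚ x , const cy *ₚ y , const cz *ₚ z ,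
    (λ (x′≈0 , y′≈0 , z′≈0) → nontrivial ( const-*-isZero cx cx≢0 x x′≈0
                                          , const-*-isZero cy cy≢0 y y′≈0
                                          , const-*-isZero cz cz≢0 z z′≈0)) ,
    λ k → ∣⇒∣ᵤ (∣-respʳ (sym (scaled k)) (∣n⇒∣m*n l (eq-∣ k)))
    where
    eq-∣ : ∀ k → P^ k ∣ (A * (res x k * res x k) + B * (res y k * res y k)) - C * (res z k * res z k)
    eq-∣ k = ∣ᵤ⇒∣ (eq k)
    expand : ∀ A′ B′ C′ cx cy cz x y z →
             A′ * (cx * x * (cx * x)) + B′ * (cy * y * (cy * y)) - C′ * (cz * z * (cz * z))
             ≡ A′ * (cx * cx) * (x * x) + B′ * (cy * cy) * (y * y) - C′ * (cz * cz) * (z * z)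
    expand = solve-∀
    factor : ∀ l A B C x y z → l * A * (x * x) + l * B * (y * y) - l * C * (z * z)
             ≡ l * ((A * (x * x) + B * (y * y)) - C * (z * z))
    factor = solve-∀
    scaled : ∀ k → let X = res x k ; Y = res y k ; Z = res z k in
             A′ * (cx * X * (cx * X)) + B′ * (cy * Y * (cy * Y)) - C′ * (cz * Z * (cz * Z))
             ≡ l * ((A * (X * X) + B * (Y * Y)) - C * (Z * Z))
    scaled k = let X = res x k ; Y = res y k ; Z = res z k in
      trans (expand A′ B′ C′ cx cy cz X Y Z)
      (trans (cong₂ (λ a b → a * (X * X) + b * (Y * Y) - C′ * (cz * cz) * (Z * Z)) eA eB)
      (trans (cong (λ c → l * A * (X * X) + l * B * (Y * Y) - c * (Z * Z)) eC)
      (factor l A B C X Y Z)))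

  Solvableℤ-intro : ∀ m n (x y z : ℤ[ p ]) → ¬ (IsZero x × IsZero y × IsZero z) →
                    (∀ k → P^ k ∣ form m n (res x k) (res y k) (res z k)) → Solvableℤ p m n
  Solvableℤ-intro m n x y z nontrivial zero-mod = x , y , z , nontrivial , λ k →
    ∣⇒∣ᵤ (∣-respʳ (cong (λ t → m * (res x k * res x k) + n * (res y k * res y k) - t) (sym (ℤP.*-identityˡ _)))
                  (zero-mod k))

  Solvableℤ-elim : ∀ {m n} → Solvableℤ p m n →
                   Σ ℤ[ p ] λ x → Σ ℤ[ p ] λ y → Σ ℤ[ p ] λ z → ¬ (IsZero x × IsZero y × IsZero z) ×
                   (∀ k → P^ k ∣ form m n (res x k) (res y k) (res z k))
  Solvableℤ-elim {m} {n} (x , y , z , nontrivial , eq) = x , y , z , nontrivial , λ k →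
    ∣-respʳ (cong (λ t → m * (res x k * res x k) + n * (res y k * res y k) - t) (ℤP.*-identityˡ _)) (eq-∣ k)
    where
    eq-∣ : ∀ k → P^ k ∣ (m * (res x k * res x k) + n * (res y k * res y k)) - 1ℤ * (res z k * res z k)
    eq-∣ k = ∣ᵤ⇒∣ (eq k)

  UnitSquareRoot : ℤ → Set
  UnitSquareRoot w = Σ ℤ[ p ] λ s → (∀ k → P^ k ∣ res s k * res s k - w) × Unit (res s 1)

  solvable-by-lifting-z : ∀ m n x₀ y₀ → UnitSquareRoot (m * (x₀ * x₀) + n * (y₀ * y₀)) → Solvableℤ p m n
  solvable-by-lifting-z m n x₀ y₀ (s , s²≡w , unit) =
    Solvableℤ-intro m n (const x₀) (const y₀) s (λ (_ , _ , s≈0) → unit-nonzero s unit s≈0)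
      λ k → ∣-respʳ (negate (m * (x₀ * x₀) + n * (y₀ * y₀)) (res s k)) (∣m⇒∣-m (s²≡w k))
    where
    negate : ∀ w s → - (s * s - w) ≡ w - s * s
    negate = solve-∀

  solvable-by-lifting-x : ∀ m n w y₀ z₀ → m * w + n * (y₀ * y₀) ≡ z₀ * z₀ → UnitSquareRoot w → Solvableℤ p m n
  solvable-by-lifting-x m n w y₀ z₀ e (s , s²≡w , unit) =
    Solvableℤ-intro m n s (const y₀) (const z₀) (λ (s≈0 , _ , _) → unit-nonzero s unit s≈0)
      λ k → ∣-respʳ (sym (form≡ (res s k))) (∣n⇒∣m*n m (s²≡w k))
    where
    expand : ∀ m n w y₀ z₀ s → m * (s * s) + n * (y₀ * y₀) - z₀ * z₀ ≡ m * (s * s - w) + ((m * w + n * (y₀ * y₀)) - z₀ * z₀)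
    expand = solve-∀
    form≡ : ∀ s → form m n s y₀ z₀ ≡ m * (s * s - w)
    form≡ s = trans (expand m n w y₀ z₀ s)
      (trans (cong (λ t → m * (s * s - w) + (t - z₀ * z₀)) e)
      (trans (cong (λ t → m * (s * s - w) + t) (ℤP.+-inverseʳ (z₀ * z₀))) (ℤP.+-identityʳ _)))

  Solvableℤ-*ˡ-unitSquare : ∀ c n w → UnitSquareRoot w → Solvableℤ p (c * w) n ⇔ Solvableℤ p c n
  Solvableℤ-*ˡ-unitSquare c n w (s , s²≡w , unit) = mk⇔ to from
    where
    to : Solvableℤ p (c * w) n → Solvableℤ p c n
    to sol with Solvableℤ-elim {c * w} {n} sol
    ... | x , y , z , nontrivial , zero-mod =
      Solvableℤ-intro c n (s *ₚ x) y z (λ (sx≈0 , y≈0 , z≈0) → nontrivial (unit-*-isZero s x unit sx≈0 , y≈0 , z≈0))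
        λ k → ∣-respʳ (sym (expand c n w (res s k) (res x k) (res y k) (res z k)))
                (∣m∣n⇒∣m+n (zero-mod k) (∣n⇒∣m*n c (∣m⇒∣m*n (res x k * res x k) (s²≡w k))))
      where
      expand : ∀ c n w s x y z → c * (s * x * (s * x)) + n * (y * y) - z * z
             ≡ (c * w * (x * x) + n * (y * y) - z * z) + c * ((s * s - w) * (x * x))
      expand = solve-∀
    from : Solvableℤ p c n → Solvableℤ p (c * w) n
    from sol with Solvableℤ-elim {c} {n} sol
    ... | x , y , z , nontrivial , zero-mod =
      Solvableℤ-intro (c * w) n x (s *ₚ y) (s *ₚ z)
        (λ (x≈0 , sy≈0 , sz≈0) → nontrivial (x≈0 , unit-*-isZero s y unit sy≈0 , unit-*-isZero s z unit sz≈0))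
        λ k → ∣-respʳ (sym (expand c n w (res s k) (res x k) (res y k) (res z k)))
                (∣m∣n⇒∣m-n (∣m∣n⇒∣m+n (∣n⇒∣m*n w (zero-mod k)) (∣n⇒∣m*n n (∣m⇒∣m*n (res y k * res y k) (s²≡w k))))
                           (∣m⇒∣m*n (res z k * res z k) (s²≡w k)))
      where
      expand : ∀ c n w s x y z → c * w * (x * x) + n * (s * y * (s * y)) - s * z * (s * z)
               ≡ (w * (c * (x * x) + n * (y * y) - z * z) + n * ((s * s - w) * (y * y))) - (s * s - w) * (z * z)
      expand = solve-∀

  Solvableℤ-*ˡ-square : ∀ t m n → t ≢ 0ℤ → Solvableℤ p (t * t * m) n ⇔ Solvableℤ p m n
  Solvableℤ-*ˡ-square t m n t≢0 = mk⇔
    (Isotropic-transfer {t * t * m} {n} {1ℤ} m n 1ℤ t 1ℤ 1ℤ 1ℤ t≢0 1≢0 1≢0 (shuffle m t) (unitˡ n) (unitˡ 1ℤ))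
    (Isotropic-transfer {m} {n} {1ℤ} (t * t * m) n 1ℤ 1ℤ t t (t * t) 1≢0 t≢0 t≢0 (unitʳ (t * t * m)) (comm n t) (comm 1ℤ t))
    where
    1≢0 : 1ℤ ≢ 0ℤ
    1≢0 ()
    shuffle : ∀ m t → m * (t * t) ≡ 1ℤ * (t * t * m)
    shuffle = solve-∀
    unitˡ : ∀ n → n * (1ℤ * 1ℤ) ≡ 1ℤ * n
    unitˡ = solve-∀
    unitʳ : ∀ a → a * (1ℤ * 1ℤ) ≡ a
    unitʳ = solve-∀
    comm : ∀ n t → n * (t * t) ≡ t * t * n
    comm = solve-∀

  Solvableℤ-*ʳ-square : ∀ t m n → t ≢ 0ℤ → Solvableℤ p m (t * t * n) ⇔ Solvableℤ p m n
  Solvableℤ-*ʳ-square t m n t≢0 = mk⇔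
    (Solvableℤ-sym {p} {n} {m} ∘ to ∘ Solvableℤ-sym {p} {m} {t * t * n})
    (Solvableℤ-sym {p} {t * t * n} {m} ∘ from ∘ Solvableℤ-sym {p} {m} {n})
    where open Equivalence (Solvableℤ-*ˡ-square t n m t≢0)

  ZerosImprimitiveMod : ℤ → ℤ → ℕ → Set
  ZerosImprimitiveMod m n e = ∀ x y z → P^ e ∣ form m n x y z → P ∣ x × P ∣ y × P ∣ z

  -- Dividing a zero by p divides the form by p², so each extra factor p² of the modulus buys one more
  -- factor p in x, y and z.
  descent : ∀ {m n} K → ZerosImprimitiveMod m n (2 ℕ.+ K) →
            ∀ j x y z → P^ (j ℕ.+ j ℕ.+ (2 ℕ.+ K)) ∣ form m n x y z → P^ suc j ∣ x × P^ suc j ∣ y × P^ suc j ∣ z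
  descent K imprimitive zero x y z d with imprimitive x y z d
  ... | P∣x , P∣y , P∣z = P^1∣ P∣x , P^1∣ P∣y , P^1∣ P∣z
    where
    P^1∣ : ∀ {t} → P ∣ t → P^ 1 ∣ t
    P^1∣ {t} = subst (_∣ t) (sym P^1)
  descent {m} {n} K imprimitive (suc j) x y z d
    with imprimitive x y z (P^-weaken (suc (suc (j ℕ.+ j))) (2 ℕ.+ K) (subst (λ e → P^ e ∣ form m n x y z) exponent d))
    where
    exponent : suc j ℕ.+ suc j ℕ.+ (2 ℕ.+ K) ≡ suc (suc (j ℕ.+ j ℕ.+ (2 ℕ.+ K)))
    exponent = cong (ℕ._+ (2 ℕ.+ K)) (ℕP.+-suc (suc j) j)
  ... | divides x′ refl , divides y′ refl , divides z′ refl =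
    P^-*-P (suc j) (proj₁ divided) ∣-refl , P^-*-P (suc j) (proj₁ (proj₂ divided)) ∣-refl ,
    P^-*-P (suc j) (proj₂ (proj₂ divided)) ∣-refl
    where
    E = j ℕ.+ j ℕ.+ (2 ℕ.+ K)
    factor : ∀ m n x y z P → m * (x * P * (x * P)) + n * (y * P * (y * P)) - z * P * (z * P)
             ≡ P * (P * (m * (x * x) + n * (y * y) - z * z))
    factor = solve-∀
    P·P·P^E∣ : P * (P * P^ E) ∣ P * (P * form m n x′ y′ z′)
    P·P·P^E∣ = subst₂ _∣_ (trans (cong P^_ (cong (ℕ._+ (2 ℕ.+ K)) (ℕP.+-suc (suc j) j)))
                                 (trans (P^-suc (suc E)) (cong (P *_) (P^-suc E))))
                          (factor m n x′ y′ z′ P) d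
    divided = descent {m} {n} K imprimitive j x′ y′ z′ (P-*-cancelˡ-∣ (P-*-cancelˡ-∣ P·P·P^E∣))

  -- At level 2k + K + 2 the residues of x, y and z are divisible by p^(k+1), so all three vanish.
  insoluble-by-descent : ∀ {m n} K → ZerosImprimitiveMod m n (2 ℕ.+ K) → ¬ Solvableℤ p m n
  insoluble-by-descent {m} {n} K imprimitive sol with Solvableℤ-elim {m} {n} sol
  ... | x , y , z , nontrivial , zero-mod =
    nontrivial (isZero-from-later x (λ k → level k , proj₁ (divides-at k)) ,
                isZero-from-later y (λ k → level k , proj₁ (proj₂ (divides-at k))) ,
                isZero-from-later z (λ k → level k , proj₂ (proj₂ (divides-at k))))
    where
    level : ℕ → ℕ
    level k = k ℕ.+ (2 ℕ.+ K)
    level-exponent : ∀ k → level k ℕ.+ k ≡ k ℕ.+ k ℕ.+ (2 ℕ.+ K)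
    level-exponent k = trans (ℕP.+-assoc k (2 ℕ.+ K) k)
                      (trans (cong (k ℕ.+_) (ℕP.+-comm (2 ℕ.+ K) k)) (sym (ℕP.+-assoc k k (2 ℕ.+ K))))
    divides-at : ∀ k → let i = level k ℕ.+ k in P^ k ∣ res x i × P^ k ∣ res y i × P^ k ∣ res z i
    divides-at k with descent {m} {n} K imprimitive k (res x i) (res y i) (res z i)
                        (subst (λ e → P^ e ∣ form m n (res x i) (res y i) (res z i)) (level-exponent k) (zero-mod i))
      where i = level k ℕ.+ k
    ... | P^k+1∣x , P^k+1∣y , P^k+1∣z = P^-suc-weaken k P^k+1∣x , P^-suc-weaken k P^k+1∣y , P^-suc-weaken k P^k+1∣z

-- Hensel lifting

module Hensel (p : ℕ) (pr : Prime p) where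
  open PrimeArithmetic p pr
  open HilbertEquation p pr using (UnitSquareRoot)

  -- Newton's iteration with the derivative frozen at t₀: s ↦ s - (s² - w) E, where E inverts 2 t₀ mod p.
  hensel : ∀ w t₀ E → P ∣ t₀ * t₀ - w → P ∣ + 2 * t₀ * E - 1ℤ → Unit t₀ → UnitSquareRoot w
  hensel w t₀ E t₀²≡w 2t₀E≡1 unit =
    record { res = s ; coh = λ k → ∣⇒∣ᵤ (step-∣ k) } , (λ k → P^-suc-weaken k (s²≡w k)) ,
    λ P∣s₁ → unit (∣-respʳ (cancel (s 1) t₀) (∣m∣n⇒∣m-n P∣s₁ (s≡t₀ 1)))
    where
    s : ℕ → ℤ
    s zero = t₀
    s (suc k) = s k - (s k * s k - w) * E

    s≡t₀ : ∀ k → P ∣ s k - t₀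
    s²≡w : ∀ k → P^ suc k ∣ s k * s k - w
    s≡t₀ zero = ∣-respʳ (sym (ℤP.+-inverseʳ t₀)) (divides 0ℤ refl)
    s≡t₀ (suc k) = ∣-respʳ (regroup (s k) t₀ (s k * s k - w) E)
                     (∣m∣n⇒∣m-n (s≡t₀ k) (∣m⇒∣m*n E (P^-suc⇒P k (s²≡w k))))
      where
      regroup : ∀ a b d E → (a - b) - d * E ≡ (a - d * E) - b
      regroup = solve-∀
    s²≡w zero = subst (_∣ t₀ * t₀ - w) (sym P^1) t₀²≡w
    s²≡w (suc k) = ∣-respʳ (expand (s k) w E) (∣m∣n⇒∣m+n linear quadratic)
      where
      d = s k * s k - w
      expand : ∀ s w E → (s * s - w) * (1ℤ - + 2 * s * E) + (s * s - w) * (s * s - w) * (E * E)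
               ≡ (s - (s * s - w) * E) * (s - (s * s - w) * E) - w
      expand = solve-∀
      regroup : ∀ s t₀ E → - (+ 2 * t₀ * E - 1ℤ + + 2 * E * (s - t₀)) ≡ 1ℤ - + 2 * s * E
      regroup = solve-∀
      P∣1-2sE : P ∣ 1ℤ - + 2 * s k * E
      P∣1-2sE = ∣-respʳ (regroup (s k) t₀ E) (∣m⇒∣-m (∣m∣n⇒∣m+n 2t₀E≡1 (∣n⇒∣m*n (+ 2 * E) (s≡t₀ k))))
      linear : P^ suc (suc k) ∣ d * (1ℤ - + 2 * s k * E)
      linear = P^-*-P (suc k) (s²≡w k) P∣1-2sE
      quadratic : P^ suc (suc k) ∣ d * d * (E * E)
      quadratic = ∣m⇒∣m*n (E * E) (P^-weaken k (suc (suc k))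
                    (subst (_∣ d * d) (trans (sym (P^-+ (suc k) (suc k))) (cong P^_ (sym (ℕP.+-suc k (suc k)))))
                      (*-pres-∣ (s²≡w k) (s²≡w k))))

    step-∣ : ∀ k → P^ k ∣ s (suc k) - s k
    step-∣ k = P^-suc-weaken k (∣-respʳ (regroup (s k) (s k * s k - w) E) (∣m⇒∣-m (∣m⇒∣m*n E (s²≡w k))))
      where
      regroup : ∀ a d E → - (d * E) ≡ (a - d * E) - a
      regroup = solve-∀

    cancel : ∀ a b → a - (a - b) ≡ b
    cancel = solve-∀

prime-2 : Prime 2
prime-2 = toWitness {a? = prime? 2} tt

module DyadicHensel where
  open PrimeArithmetic 2 prime-2
  open HilbertEquation 2 prime-2 using (UnitSquareRoot)

  -- The iteration s ↦ s (1 - 2h) keeps s² - w = 4h and raises the 2-adic order of h by one at each step.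
  hensel-2 : ∀ w → + 8 ∣ w - 1ℤ → UnitSquareRoot w
  hensel-2 w (divides c w-1≡8c) =
    record { res = s ; coh = λ k → ∣⇒∣ᵤ (step-∣ k) } ,
    (λ k → ∣-respʳ (sym (s²-w≡4h k)) (∣n⇒∣m*n (+ 4) (P^-suc-weaken k (2^k+1∣h k)))) ,
    λ 2∣s₁ → Unit-1 (∣-respʳ (cancel (s 1)) (∣m∣n⇒∣m-n 2∣s₁ (s-odd 1)))
    where
    step : ℕ → ℤ × ℤ
    step zero = 1ℤ , - (c * + 2)
    step (suc k) = let (s , h) = step k in s * (1ℤ - + 2 * h) , h * (1ℤ - s * s + h * (s * s))

    s h : ℕ → ℤ
    s k = proj₁ (step k)
    h k = proj₂ (step k)

    s²-w≡4h : ∀ k → s k * s k - w ≡ + 4 * h k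
    s²-w≡4h zero = trans (negate w) (trans (cong -_ w-1≡8c) (regroup c))
      where
      negate : ∀ w → 1ℤ * 1ℤ - w ≡ - (w - 1ℤ)
      negate = solve-∀
      regroup : ∀ c → - (c * + 8) ≡ + 4 * - (c * + 2)
      regroup = solve-∀
    s²-w≡4h (suc k) = trans (expand (s k) (h k) w)
      (trans (cong (λ t → + 4 * (h k * (1ℤ - s k * s k + h k * (s k * s k))) + (t - + 4 * h k)) (s²-w≡4h k))
      (trans (cong (λ t → + 4 * (h k * (1ℤ - s k * s k + h k * (s k * s k))) + t) (ℤP.+-inverseʳ (+ 4 * h k)))
      (ℤP.+-identityʳ _)))
      where
      expand : ∀ s h w → s * (1ℤ - + 2 * h) * (s * (1ℤ - + 2 * h)) - w
               ≡ + 4 * (h * (1ℤ - s * s + h * (s * s))) + ((s * s - w) - + 4 * h)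
      expand = solve-∀

    2^k+1∣h : ∀ k → P^ suc k ∣ h k
    8∣s²-1 : ∀ k → + 8 ∣ s k * s k - 1ℤ
    8∣s²-1 zero = divides 0ℤ refl
    8∣s²-1 (suc k) = ∣-respʳ (expand (s k) (h k))
      (∣m∣n⇒∣m-n (8∣s²-1 k) (∣m⇒∣m*n (s k * s k * (1ℤ - h k)) (*-pres-∣ {+ 4} {+ 2} ∣-refl (P^-suc⇒P k (2^k+1∣h k)))))
      where
      expand : ∀ s h → (s * s - 1ℤ) - + 4 * h * (s * s * (1ℤ - h)) ≡ s * (1ℤ - + 2 * h) * (s * (1ℤ - + 2 * h)) - 1ℤ
      expand = solve-∀
    2^k+1∣h zero = divides (- c) (regroup c)
      where
      regroup : ∀ c → - (c * + 2) ≡ - c * + 2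
      regroup = solve-∀
    2^k+1∣h (suc k) = P^-*-P (suc k) (2^k+1∣h k)
      (∣-respʳ (regroup (s k) (h k))
        (∣m∣n⇒∣m+n (∣m⇒∣-m (m*n∣⇒m∣ {+ 2} {+ 4} (8∣s²-1 k))) (∣m⇒∣m*n (s k * s k) (P^-suc⇒P k (2^k+1∣h k)))))
      where
      regroup : ∀ s h → - (s * s - 1ℤ) + h * (s * s) ≡ 1ℤ - s * s + h * (s * s)
      regroup = solve-∀

    s-odd : ∀ k → + 2 ∣ s k - 1ℤ
    s-odd zero = divides 0ℤ refl
    s-odd (suc k) = ∣-respʳ (regroup (s k) (h k)) (∣m∣n⇒∣m-n (s-odd k) (∣m⇒∣m*n (h k * s k) (∣-refl {+ 2})))
      where
      regroup : ∀ s h → (s - 1ℤ) - + 2 * (h * s) ≡ s * (1ℤ - + 2 * h) - 1ℤ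
      regroup = solve-∀

    step-∣ : ∀ k → P^ k ∣ s (suc k) - s k
    step-∣ k = ∣-respʳ (regroup (s k) (h k)) (∣m⇒∣-m (∣m⇒∣m*n (s k) (∣n⇒∣m*n (+ 2) (P^-suc-weaken k (2^k+1∣h k)))))
      where
      regroup : ∀ s h → - (+ 2 * h * s) ≡ s * (1ℤ - + 2 * h) - s
      regroup = solve-∀

    cancel : ∀ a → a - (a - 1ℤ) ≡ 1ℤ
    cancel = solve-∀

-- Quadratic residues

module QuadraticResidues (p : ℕ) (pr : Prime p) where
  open PrimeArithmetic p pr

  Unit-ℕ : ∀ {n} → 0 ℕ.< n → n ℕ.< p → Unit (+ n)
  Unit-ℕ {n@(suc _)} _ n<p P∣n = ℕP.<⇒≱ n<p (ℕD.∣⇒≤ (∣⇒∣ᵤ P∣n))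

  unit-*-cancel-mod : ∀ {u a b} → Unit u → u * a ≡ u * b ⟨mod P ⟩ → a ≡ b ⟨mod P ⟩
  unit-*-cancel-mod {u} {a} {b} uu (congruent d) with P∣x*y⇒P∣x⊎P∣y u (a - b) (∣-respʳ (factor u a b) d)
    where
    factor : ∀ u a b → u * a - u * b ≡ u * (a - b)
    factor = solve-∀
  ... | inj₁ P∣u = ⊥-elim (uu P∣u)
  ... | inj₂ P∣a-b = congruent P∣a-b

  private
    coprime : ∀ {a} → Unit a → Coprime p ℤ.∣ a ∣
    coprime ua (i∣p , i∣a) with prime⇒irreducible pr i∣p
    ... | inj₁ i≡1 = i≡1
    ... | inj₂ refl = ⊥-elim (ua (∣ᵤ⇒∣ i∣a))

    bézout-ℤ : ∀ {a b c d} → 1 ℕ.+ a ℕ.* b ≡ c ℕ.* d → 1ℤ + + a * + b ≡ + c * + d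
    bézout-ℤ {a} {b} {c} {d} eq = trans (cong (λ t → 1ℤ + t) (sym (ℤP.pos-* a b)))
                              (trans (sym (ℤP.pos-+ 1 (a ℕ.* b))) (trans (cong +_ eq) (ℤP.pos-* c d)))

    inverseℕ : ∀ n → Coprime p n → Σ ℤ λ e → + n * e ≡ 1ℤ ⟨mod P ⟩
    inverseℕ n c with coprime-Bézout c
    ... | Bézout.+- x y eq = - + y , congruent (divides (- + x)
            (trans (regroup (+ n) (+ y)) (trans (cong -_ (bézout-ℤ {y} {n} {x} {p} eq)) (ℤP.neg-distribˡ-* (+ x) P))))
      where
      regroup : ∀ n y → n * - y - 1ℤ ≡ - (1ℤ + y * n)
      regroup = solve-∀
    ... | Bézout.-+ x y eq = + y , congruent (divides (+ x)
            (trans (cong (_- 1ℤ) (trans (ℤP.*-comm (+ n) (+ y)) (sym (bézout-ℤ {x} {p} {y} {n} eq)))) (cancel (+ x * P))))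
      where
      cancel : ∀ a → 1ℤ + a - 1ℤ ≡ a
      cancel = solve-∀

  inverse : ∀ {a} → Unit a → Σ ℤ λ e → a * e ≡ 1ℤ ⟨mod P ⟩
  inverse {+ n} ua = inverseℕ n (coprime ua)
  inverse { -[1+ m ]} ua with inverseℕ (suc m) (coprime ua)
  ... | e , e-inverse = - e , subst (_≡ 1ℤ ⟨mod P ⟩) (negate (+ suc m) e) e-inverse
    where
    negate : ∀ b e → b * e ≡ (- b) * (- e)
    negate = solve-∀

  QR : ℤ → Set
  QR x = Σ ℤ λ t → x ≡ t * t ⟨mod P ⟩

  QR-resp : ∀ {a b} → a ≡ b ⟨mod P ⟩ → QR a → QR b
  QR-resp a≡b (t , a≡t²) = t , Mod.trans (Mod.sym a≡b) a≡t²

  QR-square : ∀ t → QR (t * t)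
  QR-square t = t , Mod.refl

  QR-* : ∀ {a b} → QR a → QR b → QR (a * b)
  QR-* {a} {b} (s , a≡s²) (t , b≡t²) = s * t , Mod.trans (Mod.*-cong a≡s² b≡t²) (Mod.reflexive (shuffle s t))
    where
    shuffle : ∀ s t → s * s * (t * t) ≡ s * t * (s * t)
    shuffle = solve-∀

  QR? : ∀ x → Dec (QR x)
  QR? x with FinP.any? {n = p} (λ (i : Fin p) → Mod.dec x (+ toℕ i * + toℕ i))
  ... | yes (i , x≡i²) = yes (+ toℕ i , x≡i²)
  ... | no ¬square = no λ (t , x≡t²) → ¬square (residue t , Mod.trans x≡t² (reduced t))
    where
    residue : ℤ → Fin p
    residue t = fromℕ< (ℤDM.n%ℕd<d t p)
    reduced : ∀ t → t * t ≡ + toℕ (residue t) * + toℕ (residue t) ⟨mod P ⟩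
    reduced t = subst (λ r → t * t ≡ + r * + r ⟨mod P ⟩) (sym (FinP.toℕ-fromℕ< (ℤDM.n%ℕd<d t p)))
                  (Mod.*-cong (≡%ℕ t p) (≡%ℕ t p))

  ¬QR⇒Unit : ∀ {a} → ¬ QR a → Unit a
  ¬QR⇒Unit ¬qr P∣a = ¬qr (0ℤ , Mod.∣⇒≡0 P∣a)

  square-root-Unit : ∀ {a t} → Unit a → a ≡ t * t ⟨mod P ⟩ → Unit t
  square-root-Unit ua a≡t² P∣t = ua (Mod.≡0⇒∣ (Mod.trans a≡t² (Mod.∣⇒≡0 (∣m⇒∣m*n _ P∣t))))

  QR-ratio : ∀ {x a b} → Unit b → a * a ≡ x * (b * b) ⟨mod P ⟩ → QR x
  QR-ratio {x} {a} {b} ub a²≡xb² with inverse ub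
  ... | e , be≡1 = e * a , (begin
    x                     ≡⟨ sym (ℤP.*-identityʳ x) ⟩
    x * 1ℤ                ≈⟨ Mod.*-congˡ x (Mod.*-cong be≡1 be≡1) ⟨
    x * (b * e * (b * e)) ≡⟨ shuffle x b e ⟩
    e * e * (x * (b * b)) ≈⟨ Mod.*-congˡ (e * e) a²≡xb² ⟨
    e * e * (a * a)       ≡⟨ regroup e a ⟩
    e * a * (e * a)       ∎)
    where
    open ModReasoning P
    shuffle : ∀ x b e → x * (b * e * (b * e)) ≡ e * e * (x * (b * b))
    shuffle = solve-∀
    regroup : ∀ e a → e * e * (a * a) ≡ e * a * (e * a)
    regroup = solve-∀

  QR-÷ : ∀ {a b} → Unit a → QR a → QR (a * b) → QR b
  QR-÷ {a} {b} ua (t , a≡t²) (s , ab≡s²) = QR-ratio {b} {s} {t} (square-root-Unit ua a≡t²) (begin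
    s * s       ≈⟨ ab≡s² ⟨
    a * b       ≈⟨ Mod.*-congʳ b a≡t² ⟩
    t * t * b   ≡⟨ ℤP.*-comm (t * t) b ⟩
    b * (t * t) ∎)
    where open ModReasoning P

  module OddPrime (p≢2 : p ≢ 2) where

    Unit-2 : Unit (+ 2)
    Unit-2 = Unit-ℕ (ℕ.s≤s ℕ.z≤n) (ℕP.≤∧≢⇒< 1<p (p≢2 ∘ sym))

    half : Σ ℕ λ h → p ≡ suc (h ℕ.+ h)
    half with halve p
    ... | h , inj₂ p≡2h+1 = h , p≡2h+1
    ... | h , inj₁ p≡2h with prime⇒irreducible pr (ℕD.divides h (trans p≡2h (trans (cong (h ℕ.+_) (sym (ℕP.+-identityʳ h))) (ℕP.*-comm 2 h))))
    ...   | inj₁ ()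
    ...   | inj₂ 2≡p = ⊥-elim (p≢2 (sym 2≡p))

    -- Among the p units 1², …, h², x·1², …, x·h², y (with p = 2h + 1) two are congruent mod p.  Squares of
    -- 1, …, h are pairwise incongruent and x, y are non-residues, so the coincidence must be y ≡ x t².
    private module Pigeonhole (h : ℕ) (p≡2h+1 : p ≡ suc (h ℕ.+ h)) {x y} (¬QRx : ¬ QR x) (¬QRy : ¬ QR y) where

      square : ℕ → ℤ
      square n = + n * + n

      h<p : h ℕ.< p
      h<p = subst (h ℕ.<_) (sym p≡2h+1) (ℕ.s≤s (ℕP.m≤m+n h h))

      Unit-suc : ∀ (a : Fin h) → Unit (+ suc (toℕ a))
      Unit-suc a = Unit-ℕ (ℕ.s≤s ℕ.z≤n) (ℕP.≤-<-trans (FinP.toℕ<n a) h<p)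

      Unit-square : ∀ (a : Fin h) → Unit (square (suc (toℕ a)))
      Unit-square a = Unit-* (Unit-suc a) (Unit-suc a)

      difference-of-squares : ∀ t s → t * t - s * s ≡ (t - s) * (t + s)
      difference-of-squares = solve-∀

      squares-distinct< : ∀ {s t} → 0 ℕ.< s → s ℕ.< t → t ℕ.≤ h → ¬ (square t ≡ square s ⟨mod P ⟩)
      squares-distinct< {s} {t} 0<s s<t t≤h (congruent P∣t²-s²)
        with P∣x*y⇒P∣x⊎P∣y (+ t - + s) (+ t + + s) (∣-respʳ (difference-of-squares (+ t) (+ s)) P∣t²-s²)
      ... | inj₁ P∣t-s = Unit-ℕ (ℕP.m<n⇒0<n∸m s<t) (ℕP.≤-<-trans (ℕP.m∸n≤m t s) (ℕP.≤-<-trans t≤h h<p))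
                          (∣-respʳ (trans (ℤP.m-n≡m⊖n t s) (ℤP.⊖-≥ (ℕP.<⇒≤ s<t))) P∣t-s)
      ... | inj₂ P∣t+s = Unit-ℕ (ℕP.<-≤-trans 0<s (ℕP.m≤n+m s t))
                          (subst (t ℕ.+ s ℕ.<_) (sym p≡2h+1) (ℕ.s≤s (ℕP.+-mono-≤ t≤h (ℕP.≤-trans (ℕP.<⇒≤ s<t) t≤h))))
                          (∣-respʳ (sym (ℤP.pos-+ t s)) P∣t+s)

      squares-distinct : ∀ {a b : Fin h} → a ≢ b → ¬ (square (suc (toℕ a)) ≡ square (suc (toℕ b)) ⟨mod P ⟩)
      squares-distinct {a} {b} a≢b a²≡b² with FinP.<-cmp a b
      ... | tri< a<b _ _ = squares-distinct< (ℕ.s≤s ℕ.z≤n) (ℕ.s≤s a<b) (FinP.toℕ<n b) (Mod.sym a²≡b²)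
      ... | tri≈ _ a≡b _ = a≢b a≡b
      ... | tri> _ _ b<a = squares-distinct< (ℕ.s≤s ℕ.z≤n) (ℕ.s≤s b<a) (FinP.toℕ<n a) a²≡b²

      fromSplit : Fin h ⊎ Fin h → ℤ
      fromSplit (inj₁ a) = square (suc (toℕ a))
      fromSplit (inj₂ b) = x * square (suc (toℕ b))

      candidate : Fin (suc (h ℕ.+ h)) → ℤ
      candidate zero = y
      candidate (suc i) = fromSplit (splitAt h i)

      Unit-candidate : ∀ i → Unit (candidate i)
      Unit-candidate zero = ¬QR⇒Unit ¬QRy
      Unit-candidate (suc i) with splitAt h i
      ... | inj₁ a = Unit-square a
      ... | inj₂ b = Unit-* (¬QR⇒Unit ¬QRx) (Unit-square b)

      split-collision : ∀ s s′ → s ≢ s′ → ¬ (fromSplit s ≡ fromSplit s′ ⟨mod P ⟩)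
      split-collision (inj₁ a) (inj₁ b) s≢s′ = squares-distinct (s≢s′ ∘ cong inj₁)
      split-collision (inj₁ a) (inj₂ b) _ a²≡xb² = ¬QRx (QR-ratio {x} {+ suc (toℕ a)} (Unit-suc b) a²≡xb²)
      split-collision (inj₂ a) (inj₁ b) _ xa²≡b² = ¬QRx (QR-ratio {x} {+ suc (toℕ b)} (Unit-suc a) (Mod.sym xa²≡b²))
      split-collision (inj₂ a) (inj₂ b) s≢s′ xa²≡xb² =
        squares-distinct (s≢s′ ∘ cong inj₂) (unit-*-cancel-mod (¬QR⇒Unit ¬QRx) xa²≡xb²)

      Quotient : Set
      Quotient = Σ ℤ λ t → y ≡ x * (t * t) ⟨mod P ⟩

      y-collision : ∀ s → y ≡ fromSplit s ⟨mod P ⟩ → Quotient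
      y-collision (inj₁ a) y≡a² = ⊥-elim (¬QRy (+ suc (toℕ a) , y≡a²))
      y-collision (inj₂ b) y≡xb² = + suc (toℕ b) , y≡xb²

      splitAt-injective : ∀ {i j} → splitAt h i ≡ splitAt h j → i ≡ j
      splitAt-injective {i} {j} e =
        trans (sym (FinP.join-splitAt h h i)) (trans (cong (join h h) e) (FinP.join-splitAt h h j))

      collision : ∀ i j → i ≢ j → candidate i ≡ candidate j ⟨mod P ⟩ → Quotient
      collision zero    zero    i≢j _ = ⊥-elim (i≢j refl)
      collision zero    (suc j) _   e = y-collision (splitAt h j) e
      collision (suc i) zero    _   e = y-collision (splitAt h i) (Mod.sym e)
      collision (suc i) (suc j) i≢j e =
        ⊥-elim (split-collision (splitAt h i) (splitAt h j) (i≢j ∘ cong suc ∘ splitAt-injective) e)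

      residue : Fin (suc (h ℕ.+ h)) → Fin (suc (h ℕ.+ h))
      residue i = fromℕ< (subst (candidate i ℤ.%ℕ p ℕ.<_) p≡2h+1 (ℤDM.n%ℕd<d (candidate i) p))

      candidate≡residue : ∀ i → candidate i ≡ + toℕ (residue i) ⟨mod P ⟩
      candidate≡residue i = subst (λ r → candidate i ≡ + r ⟨mod P ⟩) (sym (FinP.toℕ-fromℕ< _)) (≡%ℕ (candidate i) p)

      residue≢0 : ∀ i → zero ≢ residue i
      residue≢0 i 0≡r = Unit-candidate i
        (Mod.≡0⇒∣ (Mod.trans (candidate≡residue i) (Mod.reflexive (cong (λ r → + toℕ r) (sym 0≡r)))))

      nonzeroResidue : Fin (suc (h ℕ.+ h)) → Fin (h ℕ.+ h)
      nonzeroResidue i = punchOut (residue≢0 i)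

      nonzeroResidue-injective : ∀ i j → nonzeroResidue i ≡ nonzeroResidue j → residue i ≡ residue j
      nonzeroResidue-injective i j = FinP.punchOut-injective (residue≢0 i) (residue≢0 j)

      residues-agree : ∀ i j → residue i ≡ residue j → candidate i ≡ candidate j ⟨mod P ⟩
      residues-agree i j same =
        Mod.trans (candidate≡residue i) (Mod.trans (Mod.reflexive (cong (λ r → + toℕ r) same)) (Mod.sym (candidate≡residue j)))

      result : Quotient
      result = let i , j , i<j , same = FinP.pigeonhole (ℕP.n<1+n (h ℕ.+ h)) nonzeroResidue in
        collision i j (FinP.<⇒≢ i<j) (residues-agree i j (nonzeroResidue-injective i j same))

    -- Kept abstract: later proofs only use the existence of t, and unfolding the pigeonhole witness
    -- during their type checking blows up.
    abstract
      ¬QR-quotient : ∀ {x y} → ¬ QR x → ¬ QR y → Σ ℤ λ t → y ≡ x * (t * t) ⟨mod P ⟩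
      ¬QR-quotient = Pigeonhole.result (proj₁ half) (proj₂ half)

    ¬QR-*-¬QR : ∀ {x y} → ¬ QR x → ¬ QR y → QR (x * y)
    ¬QR-*-¬QR {x} {y} ¬QRx ¬QRy with ¬QR-quotient ¬QRx ¬QRy
    ... | t , y≡xt² = x * t , Mod.trans (Mod.*-congˡ x y≡xt²) (Mod.reflexive (regroup x t))
      where
      regroup : ∀ x t → x * (x * (t * t)) ≡ x * t * (x * t)
      regroup = solve-∀

    QR-*⇔ : ∀ {x y} → Unit x → Unit y → QR (x * y) ⇔ (QR x ⇔ QR y)
    QR-*⇔ {x} {y} ux uy = mk⇔
      (λ QRxy → mk⇔ (λ QRx → QR-÷ ux QRx QRxy) (λ QRy → QR-÷ uy QRy (subst QR (ℤP.*-comm x y) QRxy)))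
      from
      where
      from : QR x ⇔ QR y → QR (x * y)
      from x⇔y with QR? x
      ... | yes QRx = QR-* QRx (Equivalence.to x⇔y QRx)
      ... | no ¬QRx = ¬QR-*-¬QR ¬QRx (¬QRx ∘ Equivalence.from x⇔y)

    QR-then-¬QR : ∀ {u} → ¬ QR u → Σ ℕ λ k → QR (+ k) × ¬ QR (+ suc k)
    QR-then-¬QR {u} ¬QRu = descend (u ℤ.%ℕ p) (λ QRr → ¬QRu (QR-resp (Mod.sym (≡%ℕ u p)) QRr))
      where
      descend : ∀ r → ¬ QR (+ r) → Σ ℕ λ k → QR (+ k) × ¬ QR (+ suc k)
      descend zero ¬QR0 = ⊥-elim (¬QR0 (QR-square 0ℤ))
      descend (suc r) ¬QRr+1 with QR? (+ r)
      ... | yes QRr = r , QRr , ¬QRr+1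
      ... | no ¬QRr = descend r ¬QRr

-- Reduction to square classes

module ⇔-Reasoning = SetoidReasoning (⇔-setoid 0ℓ)

⇔-cong : ∀ {A A′ B B′ : Set} → A ⇔ A′ → B ⇔ B′ → (A ⇔ B) ⇔ (A′ ⇔ B′)
⇔-cong A⇔A′ B⇔B′ = mk⇔
  (λ A⇔B → mk⇔ (to B⇔B′ ∘ to A⇔B ∘ from A⇔A′) (to A⇔A′ ∘ from A⇔B ∘ from B⇔B′))
  (λ A′⇔B′ → mk⇔ (from B⇔B′ ∘ to A′⇔B′ ∘ to A⇔A′) (from A⇔A′ ∘ from A′⇔B′ ∘ to B⇔B′))
  where open Equivalence

A⇔⊤⇔A : ∀ {A : Set} → A ⇔ (⊤ ⇔ A)
A⇔⊤⇔A = mk⇔ (λ a → mk⇔ (λ _ → a) (λ _ → tt)) (λ ⊤⇔A → Equivalence.to ⊤⇔A tt)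

A⇔A⇔⊤ : ∀ {A : Set} → A ⇔ (A ⇔ ⊤)
A⇔A⇔⊤ = mk⇔ (λ a → mk⇔ (λ _ → tt) (λ _ → a)) (λ A⇔⊤ → Equivalence.from A⇔⊤ tt)

⊤⇔A⇔A : ∀ {A : Set} → ⊤ ⇔ (A ⇔ A)
⊤⇔A⇔A = mk⇔ (λ _ → mk⇔ (λ a → a) (λ a → a)) (λ _ → tt)

module SquareClasses (p : ℕ) (pr : Prime p) where
  open PrimeArithmetic p pr
  open HilbertEquation p pr

  P^[_]·_ : Bool → ℤ → ℤ
  P^[ false ]· u = u
  P^[ true ]· u = P * u

  record SquareClass (m : ℤ) : Set where
    constructor squareClass
    field
      root : ℤ
      root≢0 : root ≢ 0ℤ
      parity : Bool
      unitPart : ℤ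
      unit : Unit unitPart
      decomposition : m ≡ root * root * P^[ parity ]· unitPart

  classify : ∀ m → m ≢ 0ℤ → SquareClass m
  classify m m≢0 with factorise m m≢0
  ... | factorisation v u uu m≡P^v·u with halve v
  ...   | j , inj₁ refl = squareClass (P^ j) (P^≢0 j) false u uu (trans m≡P^v·u (cong (_* u) (P^-+ j j)))
  ...   | j , inj₂ refl = squareClass (P^ j) (P^≢0 j) true u uu
            (trans m≡P^v·u (trans (cong (_* u) (trans (P^-suc (j ℕ.+ j)) (cong (P *_) (P^-+ j j)))) (shuffle P (P^ j) u)))
    where
    shuffle : ∀ P a u → P * (a * a) * u ≡ a * a * (P * u)
    shuffle = solve-∀

  normalForm : ∀ {m} → SquareClass m → ℤ
  normalForm c = P^[ SquareClass.parity c ]· SquareClass.unitPart c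

  Solvableℤ-normalForm : ∀ {m n} (cm : SquareClass m) (cn : SquareClass n) →
                         Solvableℤ p m n ⇔ Solvableℤ p (normalForm cm) (normalForm cn)
  Solvableℤ-normalForm (squareClass t t≢0 α u _ refl) (squareClass s s≢0 β v _ refl) = begin
    Solvableℤ p (t * t * P^[ α ]· u) (s * s * P^[ β ]· v) ≈⟨ Solvableℤ-*ˡ-square t (P^[ α ]· u) (s * s * P^[ β ]· v) t≢0 ⟩
    Solvableℤ p (P^[ α ]· u) (s * s * P^[ β ]· v)         ≈⟨ Solvableℤ-*ʳ-square s (P^[ α ]· u) (P^[ β ]· v) s≢0 ⟩
    Solvableℤ p (P^[ α ]· u) (P^[ β ]· v)                 ∎
    where open ⇔-Reasoning

  private
    P^[]·-* : ∀ β v β′ v′ → Σ ℤ λ c → c ≢ 0ℤ × (P^[ β ]· v) * (P^[ β′ ]· v′) ≡ c * c * P^[ β xor β′ ]· (v * v′)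
    P^[]·-* false v false v′ = 1ℤ , (λ ()) , sym (ℤP.*-identityˡ _)
    P^[]·-* false v true  v′ = 1ℤ , (λ ()) , trans (shuffle v P v′) (sym (ℤP.*-identityˡ _))
      where
      shuffle : ∀ v P v′ → v * (P * v′) ≡ P * (v * v′)
      shuffle = solve-∀
    P^[]·-* true  v false v′ = 1ℤ , (λ ()) , trans (ℤP.*-assoc P v v′) (sym (ℤP.*-identityˡ _))
    P^[]·-* true  v true  v′ = P , (λ P≡0 → P^≢0 1 (trans P^1 P≡0)) , shuffle P v v′
      where
      shuffle : ∀ P v v′ → P * v * (P * v′) ≡ P * P * (v * v′)
      shuffle = solve-∀

  SquareClass-* : ∀ {n n′} → SquareClass n → SquareClass n′ → SquareClass (n * n′)
  SquareClass-* (squareClass s s≢0 β v uv n≡) (squareClass s′ s′≢0 β′ v′ uv′ n′≡) =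
    squareClass (s * s′ * c) (*-≢0 (*-≢0 s≢0 s′≢0) c≢0) (β xor β′) (v * v′) (Unit-* uv uv′)
      (trans (cong₂ _*_ n≡ n′≡) (trans (shuffle s s′ (P^[ β ]· v) (P^[ β′ ]· v′))
        (trans (cong (s * s * (s′ * s′) *_) e) (regroup s s′ c _))))
    where
    c = proj₁ (P^[]·-* β v β′ v′)
    c≢0 = proj₁ (proj₂ (P^[]·-* β v β′ v′))
    e = proj₂ (proj₂ (P^[]·-* β v β′ v′))
    shuffle : ∀ s s′ a b → s * s * a * (s′ * s′ * b) ≡ s * s * (s′ * s′) * (a * b)
    shuffle = solve-∀
    regroup : ∀ s s′ c w → s * s * (s′ * s′) * (c * c * w) ≡ s * s′ * c * (s * s′ * c) * w
    regroup = solve-∀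

  record SolvabilityCriterion : Set₁ where
    field
      Criterion : Bool → ℤ → Bool → ℤ → Set
      sound : ∀ α u β v → Unit u → Unit v → Criterion α u β v → Solvableℤ p (P^[ α ]· u) (P^[ β ]· v)
      complete : ∀ α u β v → Unit u → Unit v → Solvableℤ p (P^[ α ]· u) (P^[ β ]· v) → Criterion α u β v
      multiplicative : ∀ α u β v β′ v′ → Unit u → Unit v → Unit v′ →
                       Criterion α u (β xor β′) (v * v′) ⇔ (Criterion α u β v ⇔ Criterion α u β′ v′)

  module _ (criterion : SolvabilityCriterion) where
    open SolvabilityCriterion criterion

    Solvableℤ⇔Criterion : ∀ {m n} (cm : SquareClass m) (cn : SquareClass n) →
      Solvableℤ p m n ⇔ Criterion (SquareClass.parity cm) (SquareClass.unitPart cm) (SquareClass.parity cn) (SquareClass.unitPart cn)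
    Solvableℤ⇔Criterion {m} {n} cm@(squareClass _ _ α u uu _) cn@(squareClass _ _ β v uv _) = begin
      Solvableℤ p m n                       ≈⟨ Solvableℤ-normalForm cm cn ⟩
      Solvableℤ p (P^[ α ]· u) (P^[ β ]· v) ≈⟨ mk⇔ (complete α u β v uu uv) (sound α u β v uu uv) ⟩
      Criterion α u β v                     ∎
      where open ⇔-Reasoning

    Solvableℤ-*ʳ : ∀ m n n′ → m ≢ 0ℤ → n ≢ 0ℤ → n′ ≢ 0ℤ →
                   Solvableℤ p m (n * n′) ⇔ (Solvableℤ p m n ⇔ Solvableℤ p m n′)
    Solvableℤ-*ʳ m n n′ m≢0 n≢0 n′≢0 with classify m m≢0 | classify n n≢0 | classify n′ n′≢0
    ... | cm@(squareClass _ _ α u uu _) | cn@(squareClass _ _ β v uv _) | cn′@(squareClass _ _ β′ v′ uv′ _) = begin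
      Solvableℤ p m (n * n′)                            ≈⟨ Solvableℤ⇔Criterion cm (SquareClass-* cn cn′) ⟩
      Criterion α u (β xor β′) (v * v′)                 ≈⟨ multiplicative α u β v β′ v′ uu uv uv′ ⟩
      (Criterion α u β v ⇔ Criterion α u β′ v′)         ≈⟨ ⇔-cong (Solvableℤ⇔Criterion cm cn) (Solvableℤ⇔Criterion cm cn′) ⟨
      (Solvableℤ p m n ⇔ Solvableℤ p m n′)              ∎
      where open ⇔-Reasoning

-- Odd primes

module OddPrimeSolvability (p : ℕ) (pr : Prime p) (p≢2 : p ≢ 2) where
  open PrimeArithmetic p pr
  open HilbertEquation p pr
  open SquareClasses p pr
  open QuadraticResidues p pr
  open OddPrime p≢2
  open Hensel p pr

  hensel-QR : ∀ {w} → Unit w → QR w → UnitSquareRoot w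
  hensel-QR {w} uw (t₀ , w≡t₀²) with inverse {+ 2 * t₀} (Unit-* Unit-2 ut₀)
    where ut₀ = square-root-Unit {w} {t₀} uw w≡t₀²
  ... | E , 2t₀E≡1 = hensel w t₀ E (Mod.divides-diff (Mod.sym w≡t₀²)) (Mod.divides-diff 2t₀E≡1) (square-root-Unit {w} {t₀} uw w≡t₀²)

  solvable-QR : ∀ {u} n → Unit u → QR u → Solvableℤ p u n
  solvable-QR {u} n uu QRu = solvable-by-lifting-x u n u 0ℤ u (cancel u n) (hensel-QR uu QRu)
    where
    cancel : ∀ u n → u * u + n * (0ℤ * 0ℤ) ≡ u * u
    cancel = solve-∀

  -- For non-residues u, v pick k with k a residue and k + 1 not; with v ≡ u t² and s² ≡ k the value
  -- u t² + v s² ≡ u (1 + k) t² is a residue, so z can be lifted.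
  solvable-units : ∀ {u v} → Unit u → Unit v → Solvableℤ p u v
  solvable-units {u} {v} uu uv with QR? u | QR? v
  ... | yes QRu | _ = solvable-QR v uu QRu
  ... | no _ | yes QRv = Solvableℤ-sym {p} {v} {u} (solvable-QR u uv QRv)
  ... | no ¬QRu | no ¬QRv with ¬QR-quotient ¬QRu ¬QRv | QR-then-¬QR ¬QRu
  ...   | t , v≡ut² | k , (s , k≡s²) , ¬QRk+1 =
    solvable-by-lifting-z u v t s (hensel-QR (Unit-resp-≡mod (Mod.sym w≡) (Unit-* (Unit-* uu (¬QR⇒Unit ¬QRk+1)) (Unit-* ut ut)))
                                              (QR-resp (Mod.sym w≡) (QR-* (¬QR-*-¬QR ¬QRu ¬QRk+1) (QR-square t))))
    where
    ut : Unit t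
    ut P∣t = uv (Mod.≡0⇒∣ (Mod.trans v≡ut² (Mod.∣⇒≡0 (∣n⇒∣m*n u (∣m⇒∣m*n t P∣t)))))
    regroup : ∀ u t k → u * (t * t) + u * (t * t) * k ≡ u * (1ℤ + k) * (t * t)
    regroup = solve-∀
    w≡ : u * (t * t) + v * (s * s) ≡ u * (+ suc k) * (t * t) ⟨mod P ⟩
    w≡ = begin
      u * (t * t) + v * (s * s)           ≈⟨ Mod.+-cong (Mod.refl {x = u * (t * t)}) (Mod.*-cong v≡ut² (Mod.sym k≡s²)) ⟩
      u * (t * t) + u * (t * t) * + k     ≡⟨ regroup u t (+ k) ⟩
      u * (+ suc k) * (t * t)             ∎
      where open ModReasoning P

  solvable-P-P : ∀ {u v} → Unit u → Unit v → QR (- (u * v)) → Solvableℤ p (P * u) (P * v)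
  solvable-P-P {u} {v} uu uv QR-uv =
    solvable-by-lifting-x (P * u) (P * v) (- (u * v)) u 0ℤ (cancel P u v) (hensel-QR (Unit-neg (Unit-* uu uv)) QR-uv)
    where
    cancel : ∀ P u v → P * u * (- (u * v)) + P * v * (u * u) ≡ 0ℤ * 0ℤ
    cancel = solve-∀

  private
    P^2≡P*P : P^ 2 ≡ P * P
    P^2≡P*P = trans (P^-suc 1) (cong (P *_) P^1)

    P∣-unit-*-square : ∀ {v y} → Unit v → P ∣ v * (y * y) → P ∣ y
    P∣-unit-*-square {v} {y} uv P∣vy² with P∣x*y⇒P∣x⊎P∣y v (y * y) P∣vy²
    ... | inj₁ P∣v = ⊥-elim (uv P∣v)
    ... | inj₂ P∣y² = P∣x²⇒P∣x P∣y²

    P∣P* : ∀ a → P ∣ P * a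
    P∣P* a = ∣m⇒∣m*n a ∣-refl

  imprimitive-unit-P : ∀ {u v} → Unit v → ¬ QR u → ZerosImprimitiveMod u (P * v) 2
  imprimitive-unit-P {u} {v} uv ¬QRu x y z P²∣form with P ∣? x
  ... | no P∤x = ⊥-elim (¬QRu (QR-ratio {u} {z} {x} P∤x (Mod.sym (begin
    u * (x * x)                   ≡⟨ ℤP.+-identityʳ _ ⟨
    u * (x * x) + 0ℤ              ≈⟨ Mod.+-cong (Mod.refl {x = u * (x * x)}) (Mod.∣⇒≡0 P∣Pvy²) ⟨
    u * (x * x) + P * v * (y * y) ≈⟨ congruent (P^-suc⇒P 1 P²∣form) ⟩
    z * z                         ∎))))
    where
    open ModReasoning P
    P∣Pvy² : P ∣ P * v * (y * y)
    P∣Pvy² = ∣m⇒∣m*n (y * y) (P∣P* v)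
  ... | yes (divides a refl) = finish (P∣x²⇒P∣x P∣z²)
    where
    cancel : ∀ A z → A - (A - z * z) ≡ z * z
    cancel = solve-∀
    P∣z² : P ∣ z * z
    P∣z² = ∣-respʳ (cancel (u * (a * P * (a * P)) + P * v * (y * y)) z)
      (∣m∣n⇒∣m-n (∣m∣n⇒∣m+n (∣n⇒∣m*n u (∣n⇒∣m*n (a * P) (∣n⇒∣m*n a ∣-refl))) (∣m⇒∣m*n (y * y) (P∣P* v)))
                 (P^-suc⇒P 1 P²∣form))
    finish : P ∣ z → P ∣ a * P × P ∣ y × P ∣ z
    finish (divides c refl) =
      ∣n⇒∣m*n a ∣-refl ,
      P∣-unit-*-square uv (P-*-cancelˡ-∣ (∣-respʳ (expand u a P v y c)
        (∣m∣n⇒∣m-n (subst (_∣ form u (P * v) (a * P) y (c * P)) P^2≡P*P P²∣form) (∣n⇒∣m*n (u * (a * a) - c * c) (∣-refl {P * P}))))) ,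
      ∣n⇒∣m*n c ∣-refl
      where
      expand : ∀ u a P v y c → (u * (a * P * (a * P)) + P * v * (y * y) - c * P * (c * P)) - (u * (a * a) - c * c) * (P * P)
               ≡ P * (v * (y * y))
      expand = solve-∀

  imprimitive-P-P : ∀ {u v} → Unit u → ¬ QR (- (u * v)) → ZerosImprimitiveMod (P * u) (P * v) 2
  imprimitive-P-P {u} {v} uu ¬QR-uv x y z P²∣form = finish (P∣x²⇒P∣x P∣z²)
    where
    cancel : ∀ A z → A - (A - z * z) ≡ z * z
    cancel = solve-∀
    P∣z² : P ∣ z * z
    P∣z² = ∣-respʳ (cancel (P * u * (x * x) + P * v * (y * y)) z)
      (∣m∣n⇒∣m-n (∣m∣n⇒∣m+n (∣m⇒∣m*n (x * x) (P∣P* u)) (∣m⇒∣m*n (y * y) (P∣P* v))) (P^-suc⇒P 1 P²∣form))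
    P∣y : u * (x * x) + v * (y * y) ≡ 0ℤ ⟨mod P ⟩ → P ∣ y
    P∣y ux²+vy²≡0 with P ∣? y
    ... | yes P∣y = P∣y
    ... | no P∤y = ⊥-elim (¬QR-uv (QR-ratio {x = - (u * v)} {u * x} {y} P∤y (begin
      u * x * (u * x)                                     ≡⟨ expand u x v y ⟩
      u * (u * (x * x) + v * (y * y)) + - (u * v) * (y * y) ≈⟨ Mod.+-cong (Mod.*-congˡ u ux²+vy²≡0) (Mod.refl {x = - (u * v) * (y * y)}) ⟩
      u * 0ℤ + - (u * v) * (y * y)                        ≡⟨ simplify u v y ⟩
      - (u * v) * (y * y)                                 ∎)))
      where
      open ModReasoning P
      expand : ∀ u x v y → u * x * (u * x) ≡ u * (u * (x * x) + v * (y * y)) + - (u * v) * (y * y)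
      expand = solve-∀
      simplify : ∀ u v y → u * 0ℤ + - (u * v) * (y * y) ≡ - (u * v) * (y * y)
      simplify = solve-∀
    finish : P ∣ z → P ∣ x × P ∣ y × P ∣ z
    finish (divides c refl) = P∣-unit-*-square uu P∣ux² , P∣y′ , ∣n⇒∣m*n c ∣-refl
      where
      factor : ∀ u v x y c P → P * u * (x * x) + P * v * (y * y) - c * P * (c * P)
               ≡ P * (u * (x * x) + v * (y * y) - P * (c * c))
      factor = solve-∀
      P∣reduced : P ∣ u * (x * x) + v * (y * y) - P * (c * c)
      P∣reduced = P-*-cancelˡ-∣ (∣-respʳ (factor u v x y c P) (subst (_∣ form (P * u) (P * v) x y (c * P)) P^2≡P*P P²∣form))
      ux²+vy²≡0 : u * (x * x) + v * (y * y) ≡ 0ℤ ⟨mod P ⟩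
      ux²+vy²≡0 = Mod.trans (congruent P∣reduced) (Mod.∣⇒≡0 (P∣P* (c * c)))
      P∣y′ = P∣y ux²+vy²≡0
      P∣ux² : P ∣ u * (x * x)
      P∣ux² = Mod.≡0⇒∣ (Mod.trans (Mod.trans (Mod.reflexive (sym (ℤP.+-identityʳ _)))
                (Mod.+-cong (Mod.refl {x = u * (x * x)}) (Mod.sym (Mod.∣⇒≡0 (∣n⇒∣m*n v (∣n⇒∣m*n y P∣y′))))))
                ux²+vy²≡0)

  Criterion : Bool → ℤ → Bool → ℤ → Set
  Criterion false u false v = ⊤
  Criterion false u true  v = QR u
  Criterion true  u false v = QR v
  Criterion true  u true  v = QR (- (u * v))

  sound : ∀ α u β v → Unit u → Unit v → Criterion α u β v → Solvableℤ p (P^[ α ]· u) (P^[ β ]· v)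
  sound false u false v uu uv _     = solvable-units uu uv
  sound false u true  v uu uv QRu   = solvable-QR (P * v) uu QRu
  sound true  u false v uu uv QRv   = Solvableℤ-sym {p} {v} {P * u} (solvable-QR (P * u) uv QRv)
  sound true  u true  v uu uv QR-uv = solvable-P-P uu uv QR-uv

  complete : ∀ α u β v → Unit u → Unit v → Solvableℤ p (P^[ α ]· u) (P^[ β ]· v) → Criterion α u β v
  complete false u false v uu uv sol = tt
  complete false u true  v uu uv sol with QR? u
  ... | yes QRu = QRu
  ... | no ¬QRu = ⊥-elim (insoluble-by-descent {u} {P * v} 0 (imprimitive-unit-P uv ¬QRu) sol)
  complete true  u false v uu uv sol with QR? v
  ... | yes QRv = QRv
  ... | no ¬QRv = ⊥-elim (insoluble-by-descent {v} {P * u} 0 (imprimitive-unit-P uu ¬QRv) (Solvableℤ-sym {p} {P * u} {v} sol))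
  complete true  u true  v uu uv sol with QR? (- (u * v))
  ... | yes QR-uv = QR-uv
  ... | no ¬QR-uv = ⊥-elim (insoluble-by-descent {P * u} {P * v} 0 (imprimitive-P-P uu ¬QR-uv) sol)

  QR-*-square : ∀ {u z} → Unit u → QR (u * u * z) ⇔ QR z
  QR-*-square {u} uu = mk⇔ (QR-÷ (Unit-* uu uu) (QR-square u)) (QR-* (QR-square u))

  multiplicative : ∀ α u β v β′ v′ → Unit u → Unit v → Unit v′ →
                   Criterion α u (β xor β′) (v * v′) ⇔ (Criterion α u β v ⇔ Criterion α u β′ v′)
  multiplicative false u false v false v′ _ _ _ = ⊤⇔A⇔A
  multiplicative false u false v true  v′ _ _ _ = A⇔⊤⇔A
  multiplicative false u true  v false v′ _ _ _ = A⇔A⇔⊤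
  multiplicative false u true  v true  v′ _ _ _ = ⊤⇔A⇔A
  multiplicative true  u false v false v′ uu uv uv′ = QR-*⇔ uv uv′
  multiplicative true  u false v true  v′ uu uv uv′ = begin
    QR (- (u * (v * v′)))    ≡⟨ cong QR (regroup u v v′) ⟩
    QR (v * - (u * v′))      ≈⟨ QR-*⇔ uv (Unit-neg (Unit-* uu uv′)) ⟩
    (QR v ⇔ QR (- (u * v′))) ∎
    where
    open ⇔-Reasoning
    regroup : ∀ u v v′ → - (u * (v * v′)) ≡ v * - (u * v′)
    regroup = solve-∀
  multiplicative true  u true  v false v′ uu uv uv′ = begin
    QR (- (u * (v * v′)))    ≡⟨ cong QR (regroup u v v′) ⟩
    QR (- (u * v) * v′)      ≈⟨ QR-*⇔ (Unit-neg (Unit-* uu uv)) uv′ ⟩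
    (QR (- (u * v)) ⇔ QR v′) ∎
    where
    open ⇔-Reasoning
    regroup : ∀ u v v′ → - (u * (v * v′)) ≡ - (u * v) * v′
    regroup = solve-∀
  multiplicative true  u true  v true  v′ uu uv uv′ = begin
    QR (v * v′)                          ≈⟨ QR-*-square uu ⟨
    QR (u * u * (v * v′))                ≡⟨ cong QR (regroup u v v′) ⟩
    QR (- (u * v) * - (u * v′))          ≈⟨ QR-*⇔ (Unit-neg (Unit-* uu uv)) (Unit-neg (Unit-* uu uv′)) ⟩
    (QR (- (u * v)) ⇔ QR (- (u * v′)))   ∎
    where
    open ⇔-Reasoning
    regroup : ∀ u v v′ → u * u * (v * v′) ≡ - (u * v) * - (u * v′)
    regroup = solve-∀

  criterion : SolvabilityCriterion
  criterion = record { Criterion = Criterion ; sound = sound ; complete = complete ; multiplicative = multiplicative }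

-- The prime 2

module DyadicSolvability where
  open PrimeArithmetic 2 prime-2
  open HilbertEquation 2 prime-2
  open SquareClasses 2 prime-2
  open DyadicHensel

  -- An odd residue class u mod 8 is recorded by ε(u) = (u - 1)/2 and ω(u) = (u² - 1)/8 mod 2; both are
  -- additive, so multiplication of classes is componentwise xor.
  OddClass : Set
  OddClass = Bool × Bool

  pattern [1] = false , false
  pattern [3] = true  , true
  pattern [5] = false , true
  pattern [7] = true  , false

  ε ω : OddClass → Bool
  ε = proj₁
  ω = proj₂

  rep : OddClass → ℤ
  rep [1] = + 1
  rep [3] = + 3
  rep [5] = + 5
  rep [7] = + 7

  infixl 7 _·_
  _·_ : OddClass → OddClass → OddClass
  (e , o) · (e′ , o′) = e xor e′ , o xor o′

  ∀-Bool? : ∀ {A : Bool → Set} → (∀ b → Dec (A b)) → Dec (∀ b → A b)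
  ∀-Bool? A? = map′ (λ (f , t) → λ { false → f ; true → t }) (λ all → all false , all true) (A? false ×-dec A? true)

  ∀-OddClass? : ∀ {A : OddClass → Set} → (∀ c → Dec (A c)) → Dec (∀ c → A c)
  ∀-OddClass? A? = map′ (λ all (e , o) → all e o) (λ all e o → all (e , o)) (∀-Bool? λ e → ∀-Bool? λ o → A? (e , o))

  rep-· : ∀ c c′ → rep c * rep c′ ≡ rep (c · c′) ⟨mod + 8 ⟩
  rep-· = toWitness {a? = ∀-OddClass? λ c → ∀-OddClass? λ c′ → Mod.dec (rep c * rep c′) (rep (c · c′))} tt

  rep² : ∀ c → rep c * rep c ≡ 1ℤ ⟨mod + 8 ⟩
  rep² = toWitness {a? = ∀-OddClass? λ c → Mod.dec (rep c * rep c) 1ℤ} tt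

  rep-injective : ∀ c c′ → rep c ≡ rep c′ ⟨mod + 8 ⟩ → c ≡ c′
  rep-injective = toWitness {a? = ∀-OddClass? λ c → ∀-OddClass? λ c′ → Mod.dec (rep c) (rep c′) →-dec ≡-dec Bool._≟_ Bool._≟_ c c′} tt

  residueClass : ℕ → OddClass
  residueClass 3 = [3]
  residueClass 5 = [5]
  residueClass 7 = [7]
  residueClass _ = [1]

  classOf : ℤ → OddClass
  classOf u = residueClass (u ℤ.%ℕ 8)

  classOf-correct : ∀ {u} → Unit u → u ≡ rep (classOf u) ⟨mod + 8 ⟩
  classOf-correct {u} uu = fromResidue (u ℤ.%ℕ 8) (ℤDM.n%ℕd<d u 8) (≡%ℕ u 8)
    where
    even : ∀ {r} q → + r ≡ q * + 2 → ¬ (u ≡ + r ⟨mod + 8 ⟩)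
    even q r≡2q u≡r = uu (Mod.≡0⇒∣ (Mod.trans (Mod.weaken (divides (+ 4) refl) u≡r) (Mod.∣⇒≡0 (divides q r≡2q))))
    fromResidue : ∀ r → r ℕ.< 8 → u ≡ + r ⟨mod + 8 ⟩ → u ≡ rep (residueClass r) ⟨mod + 8 ⟩
    fromResidue 0 _ u≡r = ⊥-elim (even (+ 0) refl u≡r)
    fromResidue 1 _ u≡r = u≡r
    fromResidue 2 _ u≡r = ⊥-elim (even (+ 1) refl u≡r)
    fromResidue 3 _ u≡r = u≡r
    fromResidue 4 _ u≡r = ⊥-elim (even (+ 2) refl u≡r)
    fromResidue 5 _ u≡r = u≡r
    fromResidue 6 _ u≡r = ⊥-elim (even (+ 3) refl u≡r)
    fromResidue 7 _ u≡r = u≡r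
    fromResidue (suc (suc (suc (suc (suc (suc (suc (suc _))))))))
                (ℕ.s≤s (ℕ.s≤s (ℕ.s≤s (ℕ.s≤s (ℕ.s≤s (ℕ.s≤s (ℕ.s≤s (ℕ.s≤s ())))))))) _

  classOf-* : ∀ {u v} → Unit u → Unit v → classOf (u * v) ≡ classOf u · classOf v
  classOf-* {u} {v} uu uv = rep-injective _ _ (begin
    rep (classOf (u * v))          ≈⟨ classOf-correct (Unit-* uu uv) ⟨
    u * v                          ≈⟨ Mod.*-cong (classOf-correct uu) (classOf-correct uv) ⟩
    rep (classOf u) * rep (classOf v) ≈⟨ rep-· (classOf u) (classOf v) ⟩
    rep (classOf u · classOf v)    ∎)
    where open ModReasoning (+ 8)

  square-mod-16 : ∀ {x a} → x ≡ a ⟨mod + 8 ⟩ → x * x ≡ a * a ⟨mod + 16 ⟩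
  square-mod-16 {x} {a} (congruent (divides q x-a≡8q)) =
    congruent (divides (q * (q * + 4 + a)) (trans (expand x a) (trans (cong (λ d → d * (d + a + a)) x-a≡8q) (regroup q a))))
    where
    expand : ∀ x a → x * x - a * a ≡ (x - a) * ((x - a) + a + a)
    expand = solve-∀
    regroup : ∀ q a → q * + 8 * (q * + 8 + a + a) ≡ q * (q * + 4 + a) * + 16
    regroup = solve-∀

  ResiduesImprimitive : ℤ → ℤ → Set
  ResiduesImprimitive m n = ∀ (a b c : Fin 8) → let x = + toℕ a ; y = + toℕ b ; z = + toℕ c in
                       + 16 ∣ form m n x y z → P ∣ x × P ∣ y × P ∣ z

  residuesImprimitive? : ∀ m n → Dec (ResiduesImprimitive m n)
  residuesImprimitive? m n = FinP.all? λ a → FinP.all? λ b → FinP.all? λ c →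
    let x = + toℕ a ; y = + toℕ b ; z = + toℕ c in
    (+ 16 ∣? form m n x y z) →-dec (P ∣? x ×-dec P ∣? y ×-dec P ∣? z)

  private
    residue : ℤ → Fin 8
    residue t = Fin.fromℕ< (ℤDM.n%ℕd<d t 8)

    reduce : ∀ t → t ≡ + toℕ (residue t) ⟨mod + 8 ⟩
    reduce t = subst (λ r → t ≡ + r ⟨mod + 8 ⟩) (sym (FinP.toℕ-fromℕ< _)) (≡%ℕ t 8)

    P∣-lift : ∀ {t r} → t ≡ r ⟨mod + 8 ⟩ → P ∣ r → P ∣ t
    P∣-lift t≡r P∣r = Mod.≡0⇒∣ (Mod.trans (Mod.weaken (divides (+ 4) refl) t≡r) (Mod.∣⇒≡0 P∣r))

  imprimitive-from-residues : ∀ {m n} → ResiduesImprimitive m n → ZerosImprimitiveMod m n 4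
  imprimitive-from-residues {m} {n} imprimitive x y z 16∣form with imprimitive (residue x) (residue y) (residue z)
    (Mod.≡0⇒∣ (Mod.trans (Mod.sym form≡) (Mod.∣⇒≡0 16∣form)))
    where
    form≡ : form m n x y z ≡ form m n (+ toℕ (residue x)) (+ toℕ (residue y)) (+ toℕ (residue z)) ⟨mod + 16 ⟩
    form≡ = Mod.+-cong (Mod.+-cong (Mod.*-congˡ m (square-mod-16 (reduce x))) (Mod.*-congˡ n (square-mod-16 (reduce y))))
                       (Mod.-‿cong (square-mod-16 (reduce z)))
  ... | 2∣a , 2∣b , 2∣c = P∣-lift (reduce x) 2∣a , P∣-lift (reduce y) 2∣b , P∣-lift (reduce z) 2∣c

  -- (2^α u, 2^β v)₂ = (-1)^(ε(u) ε(v) + α ω(v) + β ω(u)).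
  exponent : Bool → OddClass → Bool → OddClass → Bool
  exponent α c β c′ = (ε c ∧ ε c′) xor ((α ∧ ω c′) xor (β ∧ ω c))

  data Certificate (m n : ℤ) : Bool → Set where
    lift-z : ∀ x₀ y₀ → {True (+ 8 ∣? m * (x₀ * x₀) + n * (y₀ * y₀) - 1ℤ)} → Certificate m n false
    lift-x : ∀ w y₀ z₀ → {True (m * w + n * (y₀ * y₀) ℤ.≟ z₀ * z₀)} → {True (+ 8 ∣? w - 1ℤ)} → Certificate m n false
    insoluble : {True (residuesImprimitive? m n)} → Certificate m n true

  certified : ∀ {m n b} → Certificate m n b → if b then ¬ Solvableℤ 2 m n else Solvableℤ 2 m n
  certified {m} {n} (lift-z x₀ y₀ {8∣w-1}) = solvable-by-lifting-z m n x₀ y₀ (hensel-2 _ (toWitness 8∣w-1))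
  certified {m} {n} (lift-x w y₀ z₀ {e} {8∣w-1}) = solvable-by-lifting-x m n w y₀ z₀ (toWitness e) (hensel-2 w (toWitness 8∣w-1))
  certified {m} {n} (insoluble {imprimitive}) = insoluble-by-descent {m} {n} 2 (imprimitive-from-residues {m} {n} (toWitness imprimitive))

  certificate : ∀ α c β c′ → Certificate (P^[ α ]· rep c) (P^[ β ]· rep c′) (exponent α c β c′)
  certificate false [1] false [1] = lift-z (+ 0) (+ 1)
  certificate false [1] false [3] = lift-z (+ 1) (+ 0)
  certificate false [1] false [5] = lift-z (+ 1) (+ 0)
  certificate false [1] false [7] = lift-z (+ 1) (+ 0)
  certificate false [1] true  [1] = lift-z (+ 1) (+ 0)
  certificate false [1] true  [3] = lift-z (+ 1) (+ 0)
  certificate false [1] true  [5] = lift-z (+ 1) (+ 0)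
  certificate false [1] true  [7] = lift-z (+ 1) (+ 0)
  certificate false [3] false [1] = lift-z (+ 0) (+ 1)
  certificate false [3] false [3] = insoluble
  certificate false [3] false [5] = lift-z (+ 2) (+ 1)
  certificate false [3] false [7] = insoluble
  certificate false [3] true  [1] = insoluble
  certificate false [3] true  [3] = lift-z (+ 1) (+ 1)
  certificate false [3] true  [5] = insoluble
  certificate false [3] true  [7] = lift-z (+ 1) (+ 1)
  certificate false [5] false [1] = lift-z (+ 0) (+ 1)
  certificate false [5] false [3] = lift-z (+ 1) (+ 2)
  certificate false [5] false [5] = lift-z (+ 1) (+ 2)
  certificate false [5] false [7] = lift-z (+ 1) (+ 2)
  certificate false [5] true  [1] = insoluble
  certificate false [5] true  [3] = insoluble
  certificate false [5] true  [5] = insoluble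
  certificate false [5] true  [7] = insoluble
  certificate false [7] false [1] = lift-z (+ 0) (+ 1)
  certificate false [7] false [3] = insoluble
  certificate false [7] false [5] = lift-z (+ 2) (+ 1)
  certificate false [7] false [7] = insoluble
  certificate false [7] true  [1] = lift-z (+ 1) (+ 1)
  certificate false [7] true  [3] = insoluble
  certificate false [7] true  [5] = lift-z (+ 1) (+ 1)
  certificate false [7] true  [7] = insoluble
  certificate true  [1] false [1] = lift-z (+ 0) (+ 1)
  certificate true  [1] false [3] = insoluble
  certificate true  [1] false [5] = insoluble
  certificate true  [1] false [7] = lift-z (+ 1) (+ 1)
  certificate true  [1] true  [1] = lift-x (+ 1) (+ 1) (+ 2)
  certificate true  [1] true  [3] = insoluble
  certificate true  [1] true  [5] = insoluble
  certificate true  [1] true  [7] = lift-x (- (+ 7)) (+ 1) (+ 0)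
  certificate true  [3] false [1] = lift-z (+ 0) (+ 1)
  certificate true  [3] false [3] = lift-z (+ 1) (+ 1)
  certificate true  [3] false [5] = insoluble
  certificate true  [3] false [7] = insoluble
  certificate true  [3] true  [1] = insoluble
  certificate true  [3] true  [3] = insoluble
  certificate true  [3] true  [5] = lift-x (- (+ 15)) (+ 3) (+ 0)
  certificate true  [3] true  [7] = lift-x (- (+ 15)) (+ 3) (+ 6)
  certificate true  [5] false [1] = lift-z (+ 0) (+ 1)
  certificate true  [5] false [3] = insoluble
  certificate true  [5] false [5] = insoluble
  certificate true  [5] false [7] = lift-z (+ 1) (+ 1)
  certificate true  [5] true  [1] = insoluble
  certificate true  [5] true  [3] = lift-x (- (+ 15)) (+ 5) (+ 0)
  certificate true  [5] true  [5] = lift-x (- (+ 15)) (+ 5) (+ 10)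
  certificate true  [5] true  [7] = insoluble
  certificate true  [7] false [1] = lift-z (+ 0) (+ 1)
  certificate true  [7] false [3] = lift-z (+ 1) (+ 1)
  certificate true  [7] false [5] = insoluble
  certificate true  [7] false [7] = insoluble
  certificate true  [7] true  [1] = lift-x (- (+ 7)) (+ 7) (+ 0)
  certificate true  [7] true  [3] = lift-x (- (+ 7)) (+ 7) (+ 14)
  certificate true  [7] true  [5] = insoluble
  certificate true  [7] true  [7] = insoluble

  decided : ∀ α c β c′ → if exponent α c β c′ then ¬ Solvableℤ 2 (P^[ α ]· rep c) (P^[ β ]· rep c′)
                                                  else Solvableℤ 2 (P^[ α ]· rep c) (P^[ β ]· rep c′)
  decided α c β c′ = certified (certificate α c β c′)

  exponent-· : ∀ α c β c₁ β′ c₂ → exponent α c (β xor β′) (c₁ · c₂) ≡ exponent α c β c₁ xor exponent α c β′ c₂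
  exponent-· α (e , o) β (e₁ , o₁) β′ (e₂ , o₂) = solve 9 (λ α e o β e₁ o₁ β′ e₂ o₂ →
    (e :* (e₁ :+ e₂)) :+ ((α :* (o₁ :+ o₂)) :+ ((β :+ β′) :* o))
    := ((e :* e₁) :+ ((α :* o₁) :+ (β :* o))) :+ ((e :* e₂) :+ ((α :* o₂) :+ (β′ :* o)))) refl α e o β e₁ o₁ β′ e₂ o₂
    where open xor-∧-Solver

  xor≡false⇔ : ∀ x y → (x xor y ≡ false) ⇔ ((x ≡ false) ⇔ (y ≡ false))
  xor≡false⇔ false false = mk⇔ (λ _ → mk⇔ id id) (λ _ → refl)
  xor≡false⇔ false true  = mk⇔ (λ ()) (λ f⇔t → Equivalence.to f⇔t refl)
  xor≡false⇔ true  false = mk⇔ (λ ()) (λ t⇔f → Equivalence.from t⇔f refl)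
  xor≡false⇔ true  true  = mk⇔ (λ _ → mk⇔ id id) (λ _ → refl)

  rep≢0 : ∀ c → rep c ≢ 0ℤ
  rep≢0 [1] ()
  rep≢0 [3] ()
  rep≢0 [5] ()
  rep≢0 [7] ()

  Solvableℤ-representativeˡ : ∀ α {u} n → Unit u → Solvableℤ 2 (P^[ α ]· u) n ⇔ Solvableℤ 2 (P^[ α ]· rep (classOf u)) n
  Solvableℤ-representativeˡ α {u} n uu = begin
    Solvableℤ 2 (P^[ α ]· u) n                 ≈⟨ Solvableℤ-*ˡ-square r (P^[ α ]· u) n (rep≢0 (classOf u)) ⟨
    Solvableℤ 2 (r * r * P^[ α ]· u) n         ≡⟨ cong (λ m → Solvableℤ 2 m n) (shuffle α) ⟩
    Solvableℤ 2 (P^[ α ]· r * (u * r)) n       ≈⟨ Solvableℤ-*ˡ-unitSquare (P^[ α ]· r) n (u * r) (hensel-2 (u * r) ur≡1) ⟩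
    Solvableℤ 2 (P^[ α ]· r) n                 ∎
    where
    open ⇔-Reasoning
    r = rep (classOf u)
    ur≡1 : + 8 ∣ u * r - 1ℤ
    ur≡1 = Mod.divides-diff (Mod.trans (Mod.*-congʳ r (classOf-correct uu)) (rep² (classOf u)))
    shuffle : ∀ α → r * r * P^[ α ]· u ≡ P^[ α ]· r * (u * r)
    shuffle false = regroup r u
      where
      regroup : ∀ r u → r * r * u ≡ r * (u * r)
      regroup = solve-∀
    shuffle true = regroup r u P
      where
      regroup : ∀ r u P → r * r * (P * u) ≡ P * r * (u * r)
      regroup = solve-∀

  Solvableℤ-representative : ∀ α {u} β {v} → Unit u → Unit v →
    Solvableℤ 2 (P^[ α ]· u) (P^[ β ]· v) ⇔ Solvableℤ 2 (P^[ α ]· rep (classOf u)) (P^[ β ]· rep (classOf v))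
  Solvableℤ-representative α {u} β {v} uu uv = begin
    Solvableℤ 2 (P^[ α ]· u) (P^[ β ]· v)                 ≈⟨ Solvableℤ-representativeˡ α (P^[ β ]· v) uu ⟩
    Solvableℤ 2 (P^[ α ]· r) (P^[ β ]· v)                 ≈⟨ Solvableℤ-comm (P^[ α ]· r) (P^[ β ]· v) ⟩
    Solvableℤ 2 (P^[ β ]· v) (P^[ α ]· r)                 ≈⟨ Solvableℤ-representativeˡ β (P^[ α ]· r) uv ⟩
    Solvableℤ 2 (P^[ β ]· r′) (P^[ α ]· r)                ≈⟨ Solvableℤ-comm (P^[ β ]· r′) (P^[ α ]· r) ⟩
    Solvableℤ 2 (P^[ α ]· r) (P^[ β ]· r′)                ∎
    where
    open ⇔-Reasoning
    r = rep (classOf u)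
    r′ = rep (classOf v)

  Criterion : Bool → ℤ → Bool → ℤ → Set
  Criterion α u β v = exponent α (classOf u) β (classOf v) ≡ false

  sound : ∀ α u β v → Unit u → Unit v → Criterion α u β v → Solvableℤ 2 (P^[ α ]· u) (P^[ β ]· v)
  sound α u β v uu uv e≡false = Equivalence.from (Solvableℤ-representative α β uu uv)
    (subst (λ b → if b then ¬ S else S) e≡false (decided α (classOf u) β (classOf v)))
    where S = Solvableℤ 2 (P^[ α ]· rep (classOf u)) (P^[ β ]· rep (classOf v))

  complete : ∀ α u β v → Unit u → Unit v → Solvableℤ 2 (P^[ α ]· u) (P^[ β ]· v) → Criterion α u β v
  complete α u β v uu uv sol
    with exponent α (classOf u) β (classOf v) | decided α (classOf u) β (classOf v)
  ... | false | _ = refl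
  ... | true | ¬sol = ⊥-elim (¬sol (Equivalence.to (Solvableℤ-representative α β uu uv) sol))

  multiplicative : ∀ α u β v β′ v′ → Unit u → Unit v → Unit v′ →
                   Criterion α u (β xor β′) (v * v′) ⇔ (Criterion α u β v ⇔ Criterion α u β′ v′)
  multiplicative α u β v β′ v′ uu uv uv′ = begin
    Criterion α u (β xor β′) (v * v′)            ≡⟨ cong (λ c → exponent α (classOf u) (β xor β′) c ≡ false) (classOf-* uv uv′) ⟩
    exponent α cu (β xor β′) (cv · cv′) ≡ false  ≡⟨ cong (_≡ false) (exponent-· α cu β cv β′ cv′) ⟩
    (exponent α cu β cv xor exponent α cu β′ cv′) ≡ false ≈⟨ xor≡false⇔ _ _ ⟩
    (Criterion α u β v ⇔ Criterion α u β′ v′)    ∎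
    where
    open ⇔-Reasoning
    cu = classOf u
    cv = classOf v
    cv′ = classOf v′

  criterion : SolvabilityCriterion
  criterion = record { Criterion = Criterion ; sound = sound ; complete = complete ; multiplicative = multiplicative }

-- Rational coefficients

Solvableℤ-*ʳ-at : ∀ {p} → Prime p → ∀ m n n′ → m ≢ 0ℤ → n ≢ 0ℤ → n′ ≢ 0ℤ →
                  Solvableℤ p m (n ℤ.* n′) ⇔ (Solvableℤ p m n ⇔ Solvableℤ p m n′)
Solvableℤ-*ʳ-at {p} pr with p ℕP.≟ 2
... | yes refl = SquareClasses.Solvableℤ-*ʳ 2 prime-2 DyadicSolvability.criterion
... | no p≢2 = SquareClasses.Solvableℤ-*ʳ p pr (OddPrimeSolvability.criterion p pr p≢2)

↥*↧-homo : ∀ b c → ↥ (b ℚ.* c) ℤ.* (↧ b ℤ.* ↧ c) ≡ (↥ b ℤ.* ↥ c) ℤ.* ↧ (b ℚ.* c)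
↥*↧-homo b c = trans (cong (↥ (b ℚ.* c) ℤ.*_) (sym (ℚP.↧-* b c)))
                (trans (regroup (↥ (b ℚ.* c)) (↧ (b ℚ.* c)) _) (cong (ℤ._* ↧ (b ℚ.* c)) (ℚP.↥-* b c)))
  where
  regroup : ∀ a d g → a ℤ.* (d ℤ.* g) ≡ a ℤ.* g ℤ.* d
  regroup = solve-∀

ℚ-*-≢0 : ∀ {b c} → b ≢ 0ℚ → c ≢ 0ℚ → b ℚ.* c ≢ 0ℚ
ℚ-*-≢0 {b} {c} b≢0 c≢0 bc≡0 = *-≢0 (*-≢0 (b≢0 ∘ ℚP.↥p≡0⇒p≡0 b) (c≢0 ∘ ℚP.↥p≡0⇒p≡0 c)) (λ ())
  (trans (sym (↥*↧-homo b c)) (cong (ℤ._* (↧ b ℤ.* ↧ c)) (ℚP.p≡0⇒↥p≡0 _ bc≡0)))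

module LocalSolvability (p : ℕ) (pr : Prime p) where
  open HilbertEquation p pr

  -- a and ↥a·↧a differ by the square (↧a)², so they are interchangeable in the Hilbert equation.
  N : ℚ → ℤ
  N a = ↥ a ℤ.* ↧ a

  N≢0 : ∀ {a} → a ≢ 0ℚ → N a ≢ 0ℤ
  N≢0 {a} a≢0 = *-≢0 (a≢0 ∘ ℚP.↥p≡0⇒p≡0 a) (λ ())

  -- Solvable p a b unfolds to Isotropic p (↥a ↧b) (↥b ↧a) (↧a ↧b).
  Solvable⇔Solvableℤ : ∀ a b → Solvable p a b ⇔ Solvableℤ p (N a) (N b)
  Solvable⇔Solvableℤ a b = mk⇔
    (Isotropic-transfer {↥ a ℤ.* ↧ b} {↥ b ℤ.* ↧ a} {↧ a ℤ.* ↧ b} (N a) (N b) 1ℤ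
      (↧ b) (↧ a) (↧ a ℤ.* ↧ b) (↧ a ℤ.* ↧ b) (λ ()) (λ ()) (*-≢0 {↧ a} {↧ b} (λ ()) (λ ()))
      (shuffleˡ (↥ a) (↧ a) (↧ b)) (shuffleʳ (↥ b) (↧ a) (↧ b)) (unitˡ (↧ a ℤ.* ↧ b)))
    (Isotropic-transfer {N a} {N b} {1ℤ} (↥ a ℤ.* ↧ b) (↥ b ℤ.* ↧ a) (↧ a ℤ.* ↧ b)
      (↧ a) (↧ b) 1ℤ (↧ a ℤ.* ↧ b) (λ ()) (λ ()) (λ ())
      (shuffleʳ (↥ a) (↧ a) (↧ b)) (shuffleˡ (↥ b) (↧ a) (↧ b)) (unitʳ (↧ a ℤ.* ↧ b)))
    where
    shuffleˡ : ∀ x d e → x ℤ.* d ℤ.* (e ℤ.* e) ≡ d ℤ.* e ℤ.* (x ℤ.* e)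
    shuffleˡ = solve-∀
    shuffleʳ : ∀ x d e → x ℤ.* e ℤ.* (d ℤ.* d) ≡ d ℤ.* e ℤ.* (x ℤ.* d)
    shuffleʳ = solve-∀
    unitˡ : ∀ c → 1ℤ ℤ.* (c ℤ.* c) ≡ c ℤ.* c
    unitˡ = solve-∀
    unitʳ : ∀ c → c ℤ.* (1ℤ ℤ.* 1ℤ) ≡ c ℤ.* 1ℤ
    unitʳ = solve-∀

  Solvable-sym : ∀ {a b} → Solvable p a b → Solvable p b a
  Solvable-sym {a} {b} = subst (Isotropic p (↥ b ℤ.* ↧ a) (↥ a ℤ.* ↧ b)) (ℤP.*-comm (↧ a) (↧ b))
                       ∘ Isotropic-swap {p} {↥ a ℤ.* ↧ b} {↥ b ℤ.* ↧ a} {↧ a ℤ.* ↧ b}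

  Solvable-*ʳ : ∀ {a b c} → a ≢ 0ℚ → b ≢ 0ℚ → c ≢ 0ℚ →
                Solvable p a (b ℚ.* c) ⇔ (Solvable p a b ⇔ Solvable p a c)
  Solvable-*ʳ {a} {b} {c} a≢0 b≢0 c≢0 = begin
    Solvable p a (b ℚ.* c)                        ≈⟨ Solvable⇔Solvableℤ a (b ℚ.* c) ⟩
    Solvableℤ p (N a) (N (b ℚ.* c))               ≈⟨ Solvableℤ-*ʳ-square t (N a) (N (b ℚ.* c)) (*-≢0 {↧ b} {↧ c} (λ ()) (λ ())) ⟨
    Solvableℤ p (N a) (t ℤ.* t ℤ.* N (b ℚ.* c))   ≡⟨ cong (Solvableℤ p (N a)) N-* ⟩
    Solvableℤ p (N a) (s ℤ.* s ℤ.* (N b ℤ.* N c)) ≈⟨ Solvableℤ-*ʳ-square s (N a) (N b ℤ.* N c) (λ ()) ⟩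
    Solvableℤ p (N a) (N b ℤ.* N c)               ≈⟨ Solvableℤ-*ʳ-at pr (N a) (N b) (N c) (N≢0 a≢0) (N≢0 b≢0) (N≢0 c≢0) ⟩
    (Solvableℤ p (N a) (N b) ⇔ Solvableℤ p (N a) (N c)) ≈⟨ ⇔-cong (Solvable⇔Solvableℤ a b) (Solvable⇔Solvableℤ a c) ⟨
    (Solvable p a b ⇔ Solvable p a c)             ∎
    where
    open ⇔-Reasoning
    t = ↧ b ℤ.* ↧ c
    s = ↧ (b ℚ.* c)
    N-* : t ℤ.* t ℤ.* N (b ℚ.* c) ≡ s ℤ.* s ℤ.* (N b ℤ.* N c)
    N-* = trans (regroupˡ t (↥ (b ℚ.* c)) s)
         (trans (cong (ℤ._* (t ℤ.* s)) (↥*↧-homo b c)) (regroupʳ (↥ b) (↥ c) (↧ b) (↧ c) s))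
      where
      regroupˡ : ∀ t x s → t ℤ.* t ℤ.* (x ℤ.* s) ≡ x ℤ.* t ℤ.* (t ℤ.* s)
      regroupˡ = solve-∀
      regroupʳ : ∀ nb nc db dc s → nb ℤ.* nc ℤ.* s ℤ.* (db ℤ.* dc ℤ.* s) ≡ s ℤ.* s ℤ.* (nb ℤ.* db ℤ.* (nc ℤ.* dc))
      regroupʳ = solve-∀

-- The Hasse invariant of a product

SignOf : ℤ → Set → Set
SignOf v S = (v ≡ 1ℤ × S) ⊎ (v ≡ -[1+ 0 ] × ¬ S)

sign-unique : ∀ {S S′ : Set} {v v′} → S ⇔ S′ → SignOf v S → SignOf v′ S′ → v ≡ v′
sign-unique _      (inj₁ (refl , _)) (inj₁ (refl , _)) = refl
sign-unique S⇔S′   (inj₁ (_ , s))   (inj₂ (_ , ¬s′)) = ⊥-elim (¬s′ (Equivalence.to S⇔S′ s))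
sign-unique S⇔S′   (inj₂ (_ , ¬s))  (inj₁ (_ , s′))  = ⊥-elim (¬s (Equivalence.from S⇔S′ s′))
sign-unique _      (inj₂ (refl , _)) (inj₂ (refl , _)) = refl

sign-* : ∀ {S S₁ S₂ : Set} {v v₁ v₂} → S ⇔ (S₁ ⇔ S₂) → SignOf v S → SignOf v₁ S₁ → SignOf v₂ S₂ → v ≡ v₁ ℤ.* v₂
sign-* _ (inj₁ (refl , _)) (inj₁ (refl , _)) (inj₁ (refl , _)) = refl
sign-* _ (inj₁ (refl , _)) (inj₂ (refl , _)) (inj₂ (refl , _)) = refl
sign-* _ (inj₂ (refl , _)) (inj₁ (refl , _)) (inj₂ (refl , _)) = refl
sign-* _ (inj₂ (refl , _)) (inj₂ (refl , _)) (inj₁ (refl , _)) = refl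
sign-* S⇔ (inj₁ (_ , s)) (inj₁ (_ , s₁)) (inj₂ (_ , ¬s₂)) = ⊥-elim (¬s₂ (Equivalence.to (Equivalence.to S⇔ s) s₁))
sign-* S⇔ (inj₁ (_ , s)) (inj₂ (_ , ¬s₁)) (inj₁ (_ , s₂)) = ⊥-elim (¬s₁ (Equivalence.from (Equivalence.to S⇔ s) s₂))
sign-* S⇔ (inj₂ (_ , ¬s)) (inj₁ (_ , s₁)) (inj₁ (_ , s₂)) = ⊥-elim (¬s (Equivalence.from S⇔ (mk⇔ (λ _ → s₂) (λ _ → s₁))))
sign-* S⇔ (inj₂ (_ , ¬s)) (inj₂ (_ , ¬s₁)) (inj₂ (_ , ¬s₂)) =
  ⊥-elim (¬s (Equivalence.from S⇔ (mk⇔ (⊥-elim ∘ ¬s₁) (⊥-elim ∘ ¬s₂))))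

sign-square : ∀ {S v} → SignOf v S → v ℤ.* v ≡ 1ℤ
sign-square (inj₁ (refl , _)) = refl
sign-square (inj₂ (refl , _)) = refl

record IsBimultiplicativeSymbol (h : ℚ → ℚ → ℤ) : Set where
  field
    symmetric : ∀ {a b} → a ≢ 0ℚ → b ≢ 0ℚ → h a b ≡ h b a
    *-homoʳ : ∀ {a b c} → a ≢ 0ℚ → b ≢ 0ℚ → c ≢ 0ℚ → h a (b ℚ.* c) ≡ h a b ℤ.* h a c
    square : ∀ {a b} → a ≢ 0ℚ → b ≢ 0ℚ → h a b ℤ.* h a b ≡ 1ℤ

hilbertSymbol-isBimultiplicative : ∀ {p h} → Prime p → IsHilbertSymbol p h → IsBimultiplicativeSymbol h
hilbertSymbol-isBimultiplicative {p} {h} pr isHilbert = record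
  { symmetric = λ {a} {b} a≢0 b≢0 → sign-unique (mk⇔ (Solvable-sym {a} {b}) (Solvable-sym {b} {a}))
      (isHilbert a b a≢0 b≢0) (isHilbert b a b≢0 a≢0)
  ; *-homoʳ = λ {a} {b} {c} a≢0 b≢0 c≢0 → sign-* (Solvable-*ʳ a≢0 b≢0 c≢0)
      (isHilbert a (b ℚ.* c) a≢0 (ℚ-*-≢0 b≢0 c≢0)) (isHilbert a b a≢0 b≢0) (isHilbert a c a≢0 c≢0)
  ; square = λ {a} {b} a≢0 b≢0 → sign-square (isHilbert a b a≢0 b≢0)
  }
  where open LocalSolvability p pr

NonZeroEntries : ∀ {n} → Vec ℚ n → Set
NonZeroEntries v = ∀ i → lookup v i ≢ 0ℚ

prodℚ-≢0 : ∀ {n} (v : Vec ℚ n) → NonZeroEntries v → prodℚ v ≢ 0ℚ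
prodℚ-≢0 []       _  ()
prodℚ-≢0 (q ∷ qs) nz = ℚ-*-≢0 (nz zero) (prodℚ-≢0 qs (nz ∘ suc))

prodℚ-zipWith : ∀ {n} (a b : Vec ℚ n) → prodℚ (zipWith ℚ._*_ a b) ≡ prodℚ a ℚ.* prodℚ b
prodℚ-zipWith []       []       = refl
prodℚ-zipWith (a ∷ as) (b ∷ bs) =
  trans (cong (a ℚ.* b ℚ.*_) (prodℚ-zipWith as bs)) (interchange a b (prodℚ as) (prodℚ bs))
  where open CommutativeSemigroupProperties (CommutativeMonoid.commutativeSemigroup ℚP.*-1-commutativeMonoid) using (interchange)

zipWith-≢0 : ∀ {n} (a b : Vec ℚ n) → NonZeroEntries a → NonZeroEntries b → NonZeroEntries (zipWith ℚ._*_ a b)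
zipWith-≢0 (a ∷ as) (b ∷ bs) nzA nzB zero = ℚ-*-≢0 (nzA zero) (nzB zero)
zipWith-≢0 (a ∷ as) (b ∷ bs) nzA nzB (suc i) = zipWith-≢0 as bs (nzA ∘ suc) (nzB ∘ suc) i

module BimultiplicativeSymbol {h : ℚ → ℚ → ℤ} (isSymbol : IsBimultiplicativeSymbol h) where
  open IsBimultiplicativeSymbol isSymbol

  *-homoˡ : ∀ {a b c} → a ≢ 0ℚ → b ≢ 0ℚ → c ≢ 0ℚ → h (a ℚ.* b) c ≡ h a c ℤ.* h b c
  *-homoˡ a≢0 b≢0 c≢0 = trans (symmetric (ℚ-*-≢0 a≢0 b≢0) c≢0)
    (trans (*-homoʳ c≢0 a≢0 b≢0) (cong₂ ℤ._*_ (symmetric c≢0 a≢0) (symmetric c≢0 b≢0)))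

  identityʳ : ∀ {a} → a ≢ 0ℚ → h a 1ℚ ≡ 1ℤ
  identityʳ a≢0 = trans (*-homoʳ {c = 1ℚ} a≢0 (λ ()) (λ ())) (square a≢0 (λ ()))

  squareFactorʳ : ∀ {a d r} → a ≢ 0ℚ → d ≢ 0ℚ → r ≢ 0ℚ → h a (d ℚ.* (r ℚ.* r)) ≡ h a d
  squareFactorʳ a≢0 d≢0 r≢0 = trans (*-homoʳ a≢0 d≢0 (ℚ-*-≢0 r≢0 r≢0))
    (trans (cong (h _ _ ℤ.*_) (trans (*-homoʳ a≢0 r≢0 r≢0) (square a≢0 r≢0))) (ℤP.*-identityʳ _))

  prodWith≡ : ∀ {n x} (ys : Vec ℚ n) → x ≢ 0ℚ → NonZeroEntries ys → prodWith (h x) ys ≡ h x (prodℚ ys)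
  prodWith≡ []       x≢0 _  = sym (identityʳ x≢0)
  prodWith≡ (y ∷ ys) x≢0 nz = trans (cong (h _ y ℤ.*_) (prodWith≡ ys x≢0 (nz ∘ suc)))
                                    (sym (*-homoʳ x≢0 (nz zero) (prodℚ-≢0 ys (nz ∘ suc))))

  hasse-zipWith : ∀ {n} (a b : Vec ℚ n) → NonZeroEntries a → NonZeroEntries b →
                  Hasse h (zipWith ℚ._*_ a b) ≡ Hasse h a ℤ.* Hasse h b ℤ.* h (prodℚ a) (prodℚ b) ℤ.* prodPairs h a b
  hasse-zipWith []       []       _   _   = cong (λ t → + 1 ℤ.* + 1 ℤ.* t ℤ.* + 1) (sym (identityʳ {1ℚ} (λ ())))
  hasse-zipWith (a₀ ∷ as) (b₀ ∷ bs) nzA nzB = begin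
    prodWith (h (a₀ ℚ.* b₀)) (zipWith ℚ._*_ as bs) ℤ.* Hasse h (zipWith ℚ._*_ as bs)
      ≡⟨ cong₂ ℤ._*_ leading (hasse-zipWith as bs (nzA ∘ suc) (nzB ∘ suc)) ⟩
    (h a₀ A ℤ.* h a₀ B) ℤ.* (h b₀ A ℤ.* h b₀ B) ℤ.* (Hasse h as ℤ.* Hasse h bs ℤ.* h A B ℤ.* prodPairs h as bs)
      ≡⟨ regroup (h a₀ A) (h a₀ B) (h b₀ A) (h b₀ B) (Hasse h as) (Hasse h bs) (h A B) (prodPairs h as bs) (h a₀ b₀)
                 (square a₀≢0 b₀≢0) ⟩
    (h a₀ A ℤ.* Hasse h as) ℤ.* (h b₀ B ℤ.* Hasse h bs) ℤ.* ((h a₀ b₀ ℤ.* h a₀ B) ℤ.* (h b₀ A ℤ.* h A B))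
      ℤ.* (h a₀ b₀ ℤ.* prodPairs h as bs)
      ≡⟨ cong₂ (λ u v → u ℤ.* v ℤ.* (h a₀ b₀ ℤ.* prodPairs h as bs))
               (cong₂ ℤ._*_ (cong (ℤ._* Hasse h as) (sym (prodWith≡ as a₀≢0 (nzA ∘ suc))))
                            (cong (ℤ._* Hasse h bs) (sym (prodWith≡ bs b₀≢0 (nzB ∘ suc)))))
               (sym cross) ⟩
    Hasse h (a₀ ∷ as) ℤ.* Hasse h (b₀ ∷ bs) ℤ.* h (a₀ ℚ.* A) (b₀ ℚ.* B) ℤ.* (h a₀ b₀ ℤ.* prodPairs h as bs) ∎
    where
    open ≡-Reasoning
    A = prodℚ as
    B = prodℚ bs
    a₀≢0 = nzA zero
    b₀≢0 = nzB zero
    A≢0 = prodℚ-≢0 as (nzA ∘ suc)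
    B≢0 = prodℚ-≢0 bs (nzB ∘ suc)
    leading : prodWith (h (a₀ ℚ.* b₀)) (zipWith ℚ._*_ as bs) ≡ (h a₀ A ℤ.* h a₀ B) ℤ.* (h b₀ A ℤ.* h b₀ B)
    leading = begin
      prodWith (h (a₀ ℚ.* b₀)) (zipWith ℚ._*_ as bs) ≡⟨ prodWith≡ (zipWith ℚ._*_ as bs) (ℚ-*-≢0 a₀≢0 b₀≢0)
                                                          (zipWith-≢0 as bs (nzA ∘ suc) (nzB ∘ suc)) ⟩
      h (a₀ ℚ.* b₀) (prodℚ (zipWith ℚ._*_ as bs))    ≡⟨ cong (h (a₀ ℚ.* b₀)) (prodℚ-zipWith as bs) ⟩
      h (a₀ ℚ.* b₀) (A ℚ.* B)                        ≡⟨ *-homoˡ a₀≢0 b₀≢0 (ℚ-*-≢0 A≢0 B≢0) ⟩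
      h a₀ (A ℚ.* B) ℤ.* h b₀ (A ℚ.* B)              ≡⟨ cong₂ ℤ._*_ (*-homoʳ a₀≢0 A≢0 B≢0) (*-homoʳ b₀≢0 A≢0 B≢0) ⟩
      (h a₀ A ℤ.* h a₀ B) ℤ.* (h b₀ A ℤ.* h b₀ B)    ∎
    cross : h (a₀ ℚ.* A) (b₀ ℚ.* B) ≡ (h a₀ b₀ ℤ.* h a₀ B) ℤ.* (h b₀ A ℤ.* h A B)
    cross = begin
      h (a₀ ℚ.* A) (b₀ ℚ.* B)                         ≡⟨ *-homoˡ a₀≢0 A≢0 (ℚ-*-≢0 b₀≢0 B≢0) ⟩
      h a₀ (b₀ ℚ.* B) ℤ.* h A (b₀ ℚ.* B)              ≡⟨ cong₂ ℤ._*_ (*-homoʳ a₀≢0 b₀≢0 B≢0) (*-homoʳ A≢0 b₀≢0 B≢0) ⟩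
      (h a₀ b₀ ℤ.* h a₀ B) ℤ.* (h A b₀ ℤ.* h A B)     ≡⟨ cong (λ t → (h a₀ b₀ ℤ.* h a₀ B) ℤ.* (t ℤ.* h A B)) (symmetric A≢0 b₀≢0) ⟩
      (h a₀ b₀ ℤ.* h a₀ B) ℤ.* (h b₀ A ℤ.* h A B)     ∎
    -- The two sides differ by the factor (a₀, b₀)², which is 1.
    regroup : ∀ x y z w Ha Hb k q c → c ℤ.* c ≡ 1ℤ →
              (x ℤ.* y) ℤ.* (z ℤ.* w) ℤ.* (Ha ℤ.* Hb ℤ.* k ℤ.* q)
              ≡ (x ℤ.* Ha) ℤ.* (w ℤ.* Hb) ℤ.* ((c ℤ.* y) ℤ.* (z ℤ.* k)) ℤ.* (c ℤ.* q)
    regroup x y z w Ha Hb k q c c²≡1 =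
      trans (sym (ℤP.*-identityˡ _)) (trans (cong (ℤ._* _) (sym c²≡1)) (expand x y z w Ha Hb k q c))
      where
      expand : ∀ x y z w Ha Hb k q c →
               c ℤ.* c ℤ.* ((x ℤ.* y) ℤ.* (z ℤ.* w) ℤ.* (Ha ℤ.* Hb ℤ.* k ℤ.* q))
               ≡ (x ℤ.* Ha) ℤ.* (w ℤ.* Hb) ℤ.* ((c ℤ.* y) ℤ.* (z ℤ.* k)) ℤ.* (c ℤ.* q)
      expand = solve-∀

  squareClass-invariant : ∀ {a b d e r s} → a ≢ 0ℚ → b ≢ 0ℚ → a ≡ d ℚ.* (r ℚ.* r) → b ≡ e ℚ.* (s ℚ.* s) → h a b ≡ h d e
  squareClass-invariant {a} {b} {d} {e} {r} {s} a≢0 b≢0 refl refl = begin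
    h (d ℚ.* (r ℚ.* r)) (e ℚ.* (s ℚ.* s)) ≡⟨ squareFactorʳ a≢0 e≢0 s≢0 ⟩
    h (d ℚ.* (r ℚ.* r)) e                 ≡⟨ symmetric a≢0 e≢0 ⟩
    h e (d ℚ.* (r ℚ.* r))                 ≡⟨ squareFactorʳ e≢0 d≢0 r≢0 ⟩
    h e d                                 ≡⟨ symmetric e≢0 d≢0 ⟩
    h d e                                 ∎
    where
    open ≡-Reasoning
    d≢0 : d ≢ 0ℚ
    d≢0 d≡0 = a≢0 (trans (cong (ℚ._* (r ℚ.* r)) d≡0) (ℚP.*-zeroˡ (r ℚ.* r)))
    r≢0 : r ≢ 0ℚ
    r≢0 r≡0 = a≢0 (trans (cong (λ t → d ℚ.* (t ℚ.* t)) r≡0) (ℚP.*-zeroʳ d))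
    e≢0 : e ≢ 0ℚ
    e≢0 e≡0 = b≢0 (trans (cong (ℚ._* (s ℚ.* s)) e≡0) (ℚP.*-zeroˡ (s ℚ.* s)))
    s≢0 : s ≢ 0ℚ
    s≢0 s≡0 = b≢0 (trans (cong (λ t → e ℚ.* (t ℚ.* t)) s≡0) (ℚP.*-zeroʳ e))

proposition4p2 : (n : ℕ) (a b : Vec ℚ n)
    → (∀ (i : Fin n) → lookup a i ≢ 0ℚ)
    → (∀ (i : Fin n) → lookup b i ≢ 0ℚ)
    → (p : ℕ) → Prime p
    → (h : ℚ → ℚ → ℤ) → IsHilbertSymbol p h
    → (ΔA ΔB : ℤ) → IsDiscriminant a ΔA → IsDiscriminant b ΔB
    → Hasse h (zipWith ℚ._*_ a b)
      ≡ Hasse h a ℤ.* Hasse h b ℤ.* h (toℚ ΔA) (toℚ ΔB) ℤ.* prodPairs h a b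
proposition4p2 n a b a≢0 b≢0 p pr h isHilbert ΔA ΔB (_ , rA , ∏a≡ΔA·rA²) (_ , rB , ∏b≡ΔB·rB²) = begin
  Hasse h (zipWith ℚ._*_ a b)                       ≡⟨ hasse-zipWith a b a≢0 b≢0 ⟩
  H ℤ.* h (prodℚ a) (prodℚ b) ℤ.* prodPairs h a b   ≡⟨ cong (λ t → H ℤ.* t ℤ.* prodPairs h a b) discriminants ⟩
  H ℤ.* h (toℚ ΔA) (toℚ ΔB) ℤ.* prodPairs h a b     ∎
  where
  open ≡-Reasoning
  open BimultiplicativeSymbol (hilbertSymbol-isBimultiplicative pr isHilbert)
  H = Hasse h a ℤ.* Hasse h b
  discriminants : h (prodℚ a) (prodℚ b) ≡ h (toℚ ΔA) (toℚ ΔB)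
  discriminants = squareClass-invariant {r = rA} {s = rB} (prodℚ-≢0 a a≢0) (prodℚ-≢0 b b≢0) ∏a≡ΔA·rA² ∏b≡ΔB·rB²
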